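{- Let $G$ be a threshold graph. Then $$\chi_1(G)=\begin{cases}\frac{\chi(G)}{3}+1, & \text{if } \chi(G)\equiv 0 \pmod 3 \text{ and } G \text{ is not } \omega\text{ -unique},\\[2pt] \left\lceil \frac{\chi(G)}{3}\right\rceil, & \text{otherwise.}\end{cases}$$ Moreover, every split graph $G$ satisfies $\chi_1(G)\le \left\lceil \frac{\chi(G)-1}{3}\right\rceil+1$, and this bound is tight except for bipartite $G$: for every integer $t\ge 3$ there is a split graph $G$ with $\chi(G)=t$ and $\chi_1(G)=\left\lceil \frac{t-1}{3}\right\rceil+1$. In particular, if $G$ is a split graph with $\chi(G)\equiv 1 \pmod 3$, then $\chi_1(G)=\frac{\chi(G)+2}{3}$.
   Context: All graphs are finite and simple. A 1-selection of a graph $G=(V,E)$ is a map $f$ assigning to each vertex $v$ a set $f(v)$ of at most one edge incident with $v$. The 1-removed subgraph $G_f$ has vertex set $V$ and edge set $E\setminus\bigcup_{v\in V}f(v)$. The robust chromatic number is $\chi_1(G)=\min_f \chi(G_f)$, the minimum over all 1-selections $f$ of $G$. A graph is a split graph if its vertex set can be partitioned into a clique and an independent set. A graph $G$ is a threshold graph if there exist a real $h$ and a function $g:V(G)\to\mathbb{R}$ such that distinct $x,y$ are adjacent iff $g(x)+g(y)>h$. A graph $G$ is $\omega$-unique if it contains exactly one clique of order $\omega(G)$ (the clique number).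
   Formalization: Threshold graphs are given by rational weights g and a rational threshold h rather than real ones. -}

module Defs where

open import Data.Nat using (ℕ; _+_; _∸_; _≤_; _<_)
open import Data.Nat.DivMod using (_/_)
open import Data.Bool using (Bool; true; false)
open import Data.Fin using (Fin)
open import Data.Fin.Subset using (Subset; _∈_; ∣_∣; ∁)
open import Data.Maybe using (Maybe; just; nothing)
open import Data.Product using (Σ; _×_; ∃; ∃-syntax)
open import Data.Rational using (ℚ) renaming (_+_ to _+ℚ_; _<_ to _<ℚ_)
open import Relation.Binary.PropositionalEquality using (_≡_; _≢_)
open import Relation.Nullary using (¬_)
open import Function.Bundles using (_⇔_)

record Graph (n : ℕ) : Set where
  field
    adj   : Fin n → Fin n → Bool
    sym   : ∀ x y → adj x y ≡ adj y x
    irrefl : ∀ x → adj x x ≡ false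
open Graph public

Edge : ∀ {n} → Graph n → Fin n → Fin n → Set
Edge G x y = adj G x y ≡ true

Colorable : ∀ {n} → (Fin n → Fin n → Set) → ℕ → Set
Colorable {n} E k = Σ (Fin n → Fin k) λ c → ∀ x y → E x y → c x ≢ c y

IsChromaticNumber : ∀ {n} → (Fin n → Fin n → Set) → ℕ → Set
IsChromaticNumber E k = Colorable E k × (∀ m → Colorable E m → k ≤ m)

χ≡ : ∀ {n} → Graph n → ℕ → Set
χ≡ G k = IsChromaticNumber (Edge G) k

-- 1-selection: each vertex v selects at most one edge incident with v,
-- encoded as the other endpoint (nothing = empty selection).
OneSelection : ∀ {n} → Graph n → Set
OneSelection {n} G = Σ (Fin n → Maybe (Fin n)) λ f → ∀ v u → f v ≡ just u → Edge G v u

RemovedEdge : ∀ {n} (G : Graph n) → (Fin n → Maybe (Fin n)) → Fin n → Fin n → Set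
RemovedEdge G f x y = Edge G x y × (f x ≢ just y) × (f y ≢ just x)

χ₁≡ : ∀ {n} → Graph n → ℕ → Set
χ₁≡ G k =
  (Σ (OneSelection G) λ f → IsChromaticNumber (RemovedEdge G (Data.Product.proj₁ f)) k)
  × (∀ (f : OneSelection G) m → IsChromaticNumber (RemovedEdge G (Data.Product.proj₁ f)) m → k ≤ m)

IsClique : ∀ {n} → Graph n → Subset n → Set
IsClique G S = ∀ x y → x ∈ S → y ∈ S → x ≢ y → Edge G x y

IsIndependent : ∀ {n} → Graph n → Subset n → Set
IsIndependent G S = ∀ x y → x ∈ S → y ∈ S → ¬ Edge G x y

ω≡ : ∀ {n} → Graph n → ℕ → Set
ω≡ G w = (Σ _ λ S → IsClique G S × ∣ S ∣ ≡ w) × (∀ S → IsClique G S → ∣ S ∣ ≤ w)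

ωUnique : ∀ {n} → Graph n → Set
ωUnique G = Σ ℕ λ w → ω≡ G w × (Σ _ λ S → IsClique G S × ∣ S ∣ ≡ w ×
              (∀ T → IsClique G T → ∣ T ∣ ≡ w → T ≡ S))

IsSplit : ∀ {n} → Graph n → Set
IsSplit G = Σ _ λ K → IsClique G K × IsIndependent G (∁ K)

IsThreshold : ∀ {n} → Graph n → Set
IsThreshold {n} G = Σ ℚ λ h → Σ (Fin n → ℚ) λ g →
  ∀ x y → x ≢ y → (Edge G x y ⇔ (h <ℚ g x +ℚ g y))

⌈_/3⌉ : ℕ → ℕ
⌈ a /3⌉ = (a + 2) / 3

module Submission where

-- In G_f the vertices of a clique Q sharing a colour are pairwise joined by selected edges; four of them
-- would need six, so a colour class meets Q in at most three vertices. Counting twice the vertices of Q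
-- that do not select a vertex of Q of their own colour, each class still weighs at most 3; hence
-- |Q| ≤ 3χ₁, and a clique of size 3χ₁ (resp. 3χ₁ − 1) has no (resp. at most one) such vertex.
-- Conversely, for a split graph with maximum clique Q, select cyclically within triples of Q ∖ B and give
-- the group B (a vertex, an edge or a triangle) the colour of the independent set, whose vertices select
-- their edge to a hub of B. In a threshold graph the lightest vertex of a maximum clique has no outside
-- neighbour, nor has the second lightest if the maximum clique is unique, so B can be an edge or a
-- triangle. When χ = 3χ₁, exchanging a vertex of a tight clique for a heavier outside vertex would give
-- a second tight clique, which the selection cannot serve; so the maximum clique is unique. The extremal
-- split graphs are K_t, K_{t+1} minus an edge, and K_t with a twin for each vertex.

open import Defs
  using ( Graph; adj; Edge; Colorable; IsChromaticNumber; χ≡; OneSelection; RemovedEdge; χ₁≡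
        ; IsClique; IsSplit; IsThreshold; ωUnique; ⌈_/3⌉ )

open import Data.Bool using (true; false; if_then_else_)
import Data.Bool.Properties as Bool
open import Data.Empty using (⊥; ⊥-elim)
open import Data.Fin as Fin using (Fin; zero; suc; toℕ; inject≤; fromℕ<; splitAt; _↑ˡ_; _↑ʳ_)
open import Data.Fin.Properties
  using ( _≟_; any?; all?; fromℕ<-injective; inject≤-injective; splitAt-↑ˡ; splitAt-↑ʳ; splitAt⁻¹-↑ˡ
        ; splitAt⁻¹-↑ʳ; ↑ˡ-injective; ↑ʳ-injective )
  renaming (suc-injective to fsuc-injective)
open import Data.Fin.Subset using (Subset; ∣_∣) renaming (_∈_ to _∈ₛ_)
open import Data.Fin.Subset.Properties using (⊆-antisym; x∉p⇒x∈∁p; x∈∁p⇒x∉p)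
open import Data.List using (List; []; _∷_; length; map; filter; allFin)
open import Data.List.Membership.Propositional using (_∈_; _∉_; find)
open import Data.List.Membership.Propositional.Properties using (∈-filter⁺; ∈-filter⁻; ∈-map⁺; ∈-map⁻; ∈-allFin)
import Data.List.Membership.Setoid.Properties as SetoidMembership
open import Data.List.Properties using (filter-all; length-map; length-tabulate)
open import Data.List.Relation.Binary.Subset.Propositional using (_⊆_)
open import Data.List.Relation.Unary.All as All using (All; []; _∷_)
open import Data.List.Relation.Unary.All.Properties using (¬Any⇒All¬; ¬All⇒Any¬)
open import Data.List.Relation.Unary.AllPairs using ([]; _∷_)
open import Data.List.Relation.Unary.Any as Any using (here; there)
open import Data.List.Relation.Unary.Unique.Propositional using (Unique)
import Data.List.Relation.Unary.Unique.Propositional.Properties as Unique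
open import Data.Maybe using (Maybe; just; nothing)
import Data.Maybe.Properties as Maybe
open import Data.Nat as ℕ using (ℕ; zero; suc; _+_; _*_; _∸_; _≤_; _<_; _≥_; z≤n; s≤s)
open import Data.Nat.Divisibility using (n∣m*n)
open import Data.Nat.DivMod using (_/_; _%_; m/n≡1+[m∸n]/n; +-distrib-/-∣ʳ; m*n/n≡m; /-monoˡ-≤; [m+kn]%n≡m%n)
open import Data.Nat.ListAction using (sum)
open import Data.Nat.Properties
  using ( _≤?_; ≤-refl; ≤-reflexive; ≤-trans; ≤-antisym; <-irrefl; ≰⇒>; ≤∧≢⇒<; <⇒≢; <⇒≱; m≤n⇒m≤1+n
        ; m≤n⇒m<n∨m≡n; m≤m+n; m≤n+m; m<m+n; +-mono-≤; +-monoʳ-≤; +-monoˡ-≤; +-monoʳ-<; *-monoʳ-≤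
        ; +-assoc; +-comm; +-suc; +-identityʳ; *-identityʳ; m+n∸m≡n; suc-injective; +-commutativeSemigroup
        ; module ≤-Reasoning )
open import Data.Product using (Σ; ∃; _×_; _,_; proj₁; proj₂)
import Data.Rational as ℚ
import Data.Rational.Properties as ℚ
open import Data.Sum using (_⊎_; inj₁; inj₂; [_,_]′)
import Data.Vec as Vec
import Data.Vec.Functional as Vector
open import Data.Vec.Properties using (lookup∘tabulate; []=⇒lookup; lookup⇒[]=)
open import Function using (_∘_; _⇔_; Equivalence)
open import Relation.Binary.Bundles using (DecTotalOrder)
open import Relation.Binary.PropositionalEquality
  using (_≡_; _≢_; refl; sym; trans; cong; cong₂; subst; subst₂; ≢-sym; setoid; module ≡-Reasoning)
open import Relation.Nullary using (Dec; yes; no; ¬_; does; contradiction)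
open import Relation.Nullary.Decidable using (¬?; dec-true; dec-false; _×-dec_; _→-dec_)

open import Algebra.Properties.CommutativeSemigroup +-commutativeSemigroup
  using (interchange; x∙yz≈y∙xz; xy∙z≈xz∙y)
open import Data.List.Extrema (DecTotalOrder.totalOrder ℚ.≤-decTotalOrder)
  using (argmin; argmin-sel; f[argmin]≤f[⊤]; f[argmin]≤f[xs])

private variable
  A : Set
  n k : ℕ

pattern ∈₁ = here refl
pattern ∈₂ = there ∈₁
pattern ∈₃ = there ∈₂
pattern ∈₄ = there ∈₃

_∈?_ : (x : Fin n) (L : List (Fin n)) → Dec (x ∈ L)
x ∈? L = Any.any? (x ≟_) L

index-injective : {x y : Fin n} {L : List (Fin n)} (x∈L : x ∈ L) (y∈L : y ∈ L) → Any.index x∈L ≡ Any.index y∈L → x ≡ y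
index-injective = SetoidMembership.index-injective (setoid _)

remove : Fin n → List (Fin n) → List (Fin n)
remove x = filter (λ y → ¬? (y ≟ x))

module _ {x y : Fin n} {L : List (Fin n)} where

  ∈-remove⁻ : y ∈ remove x L → y ∈ L × y ≢ x
  ∈-remove⁻ = ∈-filter⁻ (λ z → ¬? (z ≟ x))

  ∈-remove⁺ : y ∈ L → y ≢ x → y ∈ remove x L
  ∈-remove⁺ = ∈-filter⁺ (λ z → ¬? (z ≟ x))

∉-remove : (x : Fin n) (L : List (Fin n)) → x ∉ remove x L
∉-remove x L x∈ = proj₂ (∈-remove⁻ {x = x} {L = L} x∈) refl

remove-unique : (x : Fin n) {L : List (Fin n)} → Unique L → Unique (remove x L)
remove-unique x = Unique.filter⁺ (λ y → ¬? (y ≟ x))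

length-remove : {x : Fin n} {L : List (Fin n)} → Unique L → x ∈ L → suc (length (remove x L)) ≡ length L
length-remove {L = y ∷ L} (y∉L ∷ _) (here refl) with y ≟ y
... | yes _ = cong (suc ∘ length) (filter-all (λ z → ¬? (z ≟ y)) (All.map (λ y≢z z≡y → y≢z (sym z≡y)) y∉L))
... | no y≢y = ⊥-elim (y≢y refl)
length-remove {x = x} {L = y ∷ L} (y∉L ∷ uL) (there x∈L) with y ≟ x
... | yes refl = ⊥-elim (All.lookup y∉L x∈L refl)
... | no _ = cong suc (length-remove uL x∈L)

⊆-length : {L₁ L₂ : List (Fin n)} → Unique L₁ → Unique L₂ → L₁ ⊆ L₂ → length L₁ ≤ length L₂
⊆-length {L₁ = []} _ _ _ = z≤n
⊆-length {L₁ = x ∷ L₁} (x∉L₁ ∷ u₁) u₂ L₁⊆L₂ =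
  subst (suc (length L₁) ≤_) (length-remove u₂ (L₁⊆L₂ (here refl)))
    (s≤s (⊆-length u₁ (remove-unique x u₂) λ y∈L₁ →
      ∈-remove⁺ (L₁⊆L₂ (there y∈L₁)) λ y≡x → All.lookup x∉L₁ y∈L₁ (sym y≡x)))

⊆-length⇒⊇ : {L₁ L₂ : List (Fin n)} → Unique L₁ → Unique L₂ → L₁ ⊆ L₂ → length L₂ ≤ length L₁ → L₂ ⊆ L₁
⊆-length⇒⊇ {L₁ = L₁} {L₂} u₁ u₂ L₁⊆L₂ L₂≤L₁ {x} x∈L₂ with x ∈? L₁
... | yes x∈L₁ = x∈L₁
... | no x∉L₁ = ⊥-elim (<-irrefl refl
  (≤-trans (s≤s (⊆-length u₁ (remove-unique x u₂) λ y∈L₁ → ∈-remove⁺ (L₁⊆L₂ y∈L₁) λ { refl → x∉L₁ y∈L₁ }))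
           (≤-trans (≤-reflexive (length-remove u₂ x∈L₂)) L₂≤L₁)))

sum-map-∈ : (w : A → ℕ) {x : A} {L : List A} → x ∈ L → w x ≤ sum (map w L)
sum-map-∈ w {L = y ∷ L} (here refl) = m≤m+n (w y) _
sum-map-∈ w {L = y ∷ L} (there x∈L) = ≤-trans (sum-map-∈ w x∈L) (m≤n+m _ (w y))

sum-map-∈₂ : (w : A → ℕ) {x y : A} {L : List A} → Unique L → x ∈ L → y ∈ L → x ≢ y → w x + w y ≤ sum (map w L)
sum-map-∈₂ w _ (here refl) (here refl) x≢y = ⊥-elim (x≢y refl)
sum-map-∈₂ w {L = z ∷ L} _ (here refl) (there y∈L) _ = +-monoʳ-≤ (w z) (sum-map-∈ w y∈L)
sum-map-∈₂ w {x} {L = z ∷ L} _ (there x∈L) (here refl) _ =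
  subst (_≤ w z + sum (map w L)) (+-comm (w z) (w x)) (+-monoʳ-≤ (w z) (sum-map-∈ w x∈L))
sum-map-∈₂ w {L = z ∷ L} (_ ∷ uL) (there x∈L) (there y∈L) x≢y =
  ≤-trans (sum-map-∈₂ w uL x∈L y∈L x≢y) (m≤n+m _ (w z))

sum-map-suc : (w : A → ℕ) (L : List A) → sum (map (suc ∘ w) L) ≡ length L + sum (map w L)
sum-map-suc w [] = refl
sum-map-suc w (x ∷ L) = cong suc (trans (cong (w x +_) (sum-map-suc w L)) (x∙yz≈y∙xz (w x) (length L) _))

length-filter-+ : {P : A → Set} (P? : ∀ x → Dec (P x)) (L : List A) →
  length (filter P? L) + length (filter (¬? ∘ P?) L) ≡ length L
length-filter-+ P? [] = refl
length-filter-+ P? (x ∷ L) with P? x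
... | yes _ = cong suc (length-filter-+ P? L)
... | no _ = trans (+-suc _ _) (cong suc (length-filter-+ P? L))

length-without : {S L : List (Fin n)} → Unique S → Unique L → S ⊆ L →
  length (filter (λ x → ¬? (x ∈? S)) L) ≡ length L ∸ length S
length-without {S = S} {L} uS uL S⊆L = begin
  length out                          ≡⟨ sym (m+n∸m≡n (length S) (length out)) ⟩
  length S + length out ∸ length S    ≡⟨ cong (λ m → m + length out ∸ length S) (sym length-in) ⟩
  length in′ + length out ∸ length S  ≡⟨ cong (_∸ length S) (length-filter-+ (_∈? S) L) ⟩
  length L ∸ length S                 ∎
  where
  open ≡-Reasoning
  in′ = filter (_∈? S) L
  out = filter (¬? ∘ (_∈? S)) L
  length-in : length in′ ≡ length S
  length-in = ≤-antisym (⊆-length (Unique.filter⁺ (_∈? S) uL) uS (proj₂ ∘ ∈-filter⁻ (_∈? S) {xs = L}))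
                        (⊆-length uS (Unique.filter⁺ (_∈? S) uL) λ x∈S → ∈-filter⁺ (_∈? S) (S⊆L x∈S) x∈S)

length-allFin : (t : ℕ) → length (allFin t) ≡ t
length-allFin t = length-tabulate (λ i → i)

nonempty-member : (L : List A) {m : ℕ} → length L ≡ suc m → ∃ λ x → x ∈ L
nonempty-member (x ∷ _) _ = x , here refl

-- Double counting over colour classes

∑ : (Fin k → ℕ) → ℕ
∑ {zero} F = 0
∑ {suc k} F = F zero + ∑ (F ∘ suc)

∑-zero : ∑ {k} (λ _ → 0) ≡ 0
∑-zero {zero} = refl
∑-zero {suc k} = ∑-zero {k}

∑-cong : {F G : Fin k → ℕ} → (∀ j → F j ≡ G j) → ∑ F ≡ ∑ G
∑-cong {zero} F≡G = refl
∑-cong {suc k} F≡G = cong₂ _+_ (F≡G zero) (∑-cong (F≡G ∘ suc))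

∑-+ : (F G : Fin k → ℕ) → ∑ (λ j → F j + G j) ≡ ∑ F + ∑ G
∑-+ {zero} F G = refl
∑-+ {suc k} F G = trans (cong (F zero + G zero +_) (∑-+ (F ∘ suc) (G ∘ suc))) (interchange (F zero) (G zero) _ _)

∑-≤ : {F : Fin k → ℕ} (B : ℕ) → (∀ j → F j ≤ B) → ∑ F ≤ k * B
∑-≤ {zero} B F≤B = z≤n
∑-≤ {suc k} B F≤B = +-mono-≤ (F≤B zero) (∑-≤ B (F≤B ∘ suc))

indicator : Fin k → ℕ → Fin k → ℕ
indicator i a j = if does (i ≟ j) then a else 0

∑-indicator : (i : Fin k) (a : ℕ) → ∑ (indicator i a) ≡ a
∑-indicator {suc k} zero a = trans (cong (a +_) (∑-zero {k})) (+-identityʳ a)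
∑-indicator (suc i) a = ∑-indicator i a

colourClass : (A → Fin k) → Fin k → List A → List A
colourClass c j = filter (λ x → c x ≟ j)

module _ (c : A → Fin k) (j : Fin k) (L : List A) where

  ∈-colourClass⁻ : ∀ {x} → x ∈ colourClass c j L → x ∈ L × c x ≡ j
  ∈-colourClass⁻ = ∈-filter⁻ (λ x → c x ≟ j)

  colourClass-unique : Unique L → Unique (colourClass c j L)
  colourClass-unique = Unique.filter⁺ (λ x → c x ≟ j)

sum-colourClass-∷ : (c : A → Fin k) (w : A → ℕ) (x : A) (L : List A) (j : Fin k) →
  sum (map w (colourClass c j (x ∷ L))) ≡ indicator (c x) (w x) j + sum (map w (colourClass c j L))
sum-colourClass-∷ c w x L j with c x ≟ j
... | yes _ = refl
... | no _ = refl

sum≡∑-colourClasses : (c : A → Fin k) (w : A → ℕ) (L : List A) →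
  sum (map w L) ≡ ∑ (λ j → sum (map w (colourClass c j L)))
sum≡∑-colourClasses {k = k} c w [] = sym (∑-zero {k})
sum≡∑-colourClasses c w (x ∷ L) = begin
  w x + sum (map w L)
    ≡⟨ cong₂ _+_ (sym (∑-indicator (c x) (w x))) (sum≡∑-colourClasses c w L) ⟩
  ∑ (indicator (c x) (w x)) + ∑ (λ j → sum (map w (colourClass c j L)))
    ≡⟨ sym (∑-+ (indicator (c x) (w x)) _) ⟩
  ∑ (λ j → indicator (c x) (w x) j + sum (map w (colourClass c j L)))
    ≡⟨ ∑-cong (λ j → sym (sum-colourClass-∷ c w x L j)) ⟩
  ∑ (λ j → sum (map w (colourClass c j (x ∷ L)))) ∎
  where open ≡-Reasoning

sum≤-colourClasses : (c : A → Fin k) (w : A → ℕ) (B : ℕ) (L : List A) →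
  (∀ j → sum (map w (colourClass c j L)) ≤ B) → sum (map w L) ≤ k * B
sum≤-colourClasses c w B L class≤B = subst (_≤ _) (sym (sum≡∑-colourClasses c w L)) (∑-≤ B class≤B)

sum-map-1 : (L : List A) → sum (map (λ _ → 1) L) ≡ length L
sum-map-1 [] = refl
sum-map-1 (_ ∷ L) = cong suc (sum-map-1 L)

length≤-colourClasses : (c : A → Fin k) (B : ℕ) (L : List A) →
  (∀ j → length (colourClass c j L) ≤ B) → length L ≤ k * B
length≤-colourClasses c B L class≤B = subst (_≤ _) (sum-map-1 L)
  (sum≤-colourClasses c (λ _ → 1) B L λ j → subst (_≤ B) (sym (sum-map-1 (colourClass c j L))) (class≤B j))

Edge-sym : (G : Graph n) {x y : Fin n} → Edge G x y → Edge G y x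
Edge-sym G {x} {y} = trans (Graph.sym G y x)

Edge⇒≢ : (G : Graph n) {x y : Fin n} → Edge G x y → x ≢ y
Edge⇒≢ G {x} xy refl with () ← trans (sym (Graph.irrefl G x)) xy

Edge? : (G : Graph n) (x y : Fin n) → Dec (Edge G x y)
Edge? G x y = adj G x y Bool.≟ true

record IsCliqueList (G : Graph n) (L : List (Fin n)) : Set where
  field
    distinct : Unique L
    adjacent : ∀ {x y} → x ∈ L → y ∈ L → x ≢ y → Edge G x y
open IsCliqueList public

module _ {G : Graph n} {L : List (Fin n)} (L-clique : IsCliqueList G L) where

  ⊆-clique : {L′ : List (Fin n)} → Unique L′ → L′ ⊆ L → IsCliqueList G L′
  ⊆-clique uL′ L′⊆L = record { distinct = uL′ ; adjacent = λ x∈ y∈ → adjacent L-clique (L′⊆L x∈) (L′⊆L y∈) }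

  remove-clique : (x : Fin n) → IsCliqueList G (remove x L)
  remove-clique x = ⊆-clique (remove-unique x (distinct L-clique)) (proj₁ ∘ ∈-remove⁻)

  ∷-clique : {v : Fin n} → v ∉ L → (∀ {y} → y ∈ L → Edge G v y) → IsCliqueList G (v ∷ L)
  ∷-clique {v} v∉L v~L = record { distinct = ¬Any⇒All¬ L v∉L ∷ distinct L-clique ; adjacent = adj′ }
    where
    adj′ : ∀ {x y} → x ∈ v ∷ L → y ∈ v ∷ L → x ≢ y → Edge G x y
    adj′ (here refl) (here refl) x≢y = ⊥-elim (x≢y refl)
    adj′ (here refl) (there y∈L) _ = v~L y∈L
    adj′ (there x∈L) (here refl) _ = Edge-sym G (v~L x∈L)
    adj′ (there x∈L) (there y∈L) x≢y = adjacent L-clique x∈L y∈L x≢y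

at-most-one : {L : List A} → Unique L → (∀ {x y} → x ∈ L → y ∈ L → x ≢ y → ⊥) → length L ≤ 1
at-most-one {L = []} _ _ = z≤n
at-most-one {L = _ ∷ []} _ _ = s≤s z≤n
at-most-one {L = _ ∷ _ ∷ _} ((x≢y ∷ _) ∷ _) no-pair = ⊥-elim (no-pair ∈₁ ∈₂ x≢y)

at-most-two : {L : List A} → Unique L → (∀ {x y z} → x ∈ L → y ∈ L → z ∈ L → x ≢ y → x ≢ z → y ≢ z → ⊥) → length L ≤ 2
at-most-two {L = []} _ _ = z≤n
at-most-two {L = _ ∷ []} _ _ = s≤s z≤n
at-most-two {L = _ ∷ _ ∷ []} _ _ = s≤s (s≤s z≤n)
at-most-two {L = _ ∷ _ ∷ _ ∷ _} ((x≢y ∷ x≢z ∷ _) ∷ (y≢z ∷ _) ∷ _) no-triple = ⊥-elim (no-triple ∈₁ ∈₂ ∈₃ x≢y x≢z y≢z)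

clique≤colours : (G : Graph n) {L : List (Fin n)} → Colorable (Edge G) k → IsCliqueList G L → length L ≤ k
clique≤colours {k = k} G {L} (c , proper) L-clique =
  subst (length L ≤_) (*-identityʳ k) (length≤-colourClasses c 1 L λ j →
    at-most-one (colourClass-unique c j L (distinct L-clique)) λ x∈ y∈ x≢y →
      let (x∈L , cx≡j) = ∈-colourClass⁻ c j L x∈ ; (y∈L , cy≡j) = ∈-colourClass⁻ c j L y∈ in
      proper _ _ (adjacent L-clique x∈L y∈L x≢y) (trans cx≡j (sym cy≡j)))

clique-colouring⇒χ : (G : Graph n) {L : List (Fin n)} {χ : ℕ} → χ≡ G χ →
  IsCliqueList G L → Colorable (Edge G) (length L) → length L ≡ χ
clique-colouring⇒χ G (χ-colouring , χ-least) L-clique L-colouring =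
  ≤-antisym (clique≤colours G χ-colouring L-clique) (χ-least _ L-colouring)

Colorable-≤ : {E : Fin n → Fin n → Set} {a b : ℕ} → Colorable E a → a ≤ b → Colorable E b
Colorable-≤ (c , proper) a≤b = (λ x → inject≤ (c x) a≤b) ,
  λ x y xy cx≡cy → proper x y xy (inject≤-injective a≤b a≤b (c x) (c y) cx≡cy)

∃-function? : ∀ n k (P : (Fin n → Fin k) → Set) → (∀ {c c′} → (∀ i → c i ≡ c′ i) → P c → P c′) →
  (∀ c → Dec (P c)) → Dec (Σ (Fin n → Fin k) P)
∃-function? zero k P resp P? with P? (λ ())
... | yes p = yes (_ , p)
... | no ¬p = no λ (c , p) → ¬p (resp (λ ()) p)
∃-function? (suc n) k P resp P? with any? (λ a → ∃-function? n k (P ∘ (a Vector.∷_))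
                                     (λ c≗c′ → resp λ { zero → refl ; (suc i) → c≗c′ i }) (P? ∘ (a Vector.∷_)))
... | yes (a , c , p) = yes (a Vector.∷ c , p)
... | no ¬p = no λ (c , p) → ¬p (c zero , c ∘ suc , resp (λ { zero → refl ; (suc i) → refl }) p)

Colorable? : (E : Fin n → Fin n → Set) → (∀ x y → Dec (E x y)) → ∀ k → Dec (Colorable E k)
Colorable? {n} E E? k = ∃-function? n k (λ c → ∀ x y → E x y → c x ≢ c y)
  (λ c≗c′ proper x y xy c′x≡c′y → proper x y xy (trans (c≗c′ x) (trans c′x≡c′y (sym (c≗c′ y)))))
  (λ c → all? λ x → all? λ y → E? x y →-dec ¬? (c x ≟ c y))

chromatic-number-≤ : (E : Fin n → Fin n → Set) → (∀ x y → Dec (E x y)) → ∀ m → Colorable E m →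
  Σ ℕ λ k → k ≤ m × IsChromaticNumber E k
chromatic-number-≤ E E? zero colouring = 0 , z≤n , colouring , λ _ _ → z≤n
chromatic-number-≤ E E? (suc m) colouring with Colorable? E E? m
... | yes colouring′ = let (k , k≤m , χ-k) = chromatic-number-≤ E E? m colouring′ in k , m≤n⇒m≤1+n k≤m , χ-k
... | no ¬colouring = suc m , ≤-refl , colouring , least
  where
  least : ∀ m′ → Colorable E m′ → suc m ≤ m′
  least m′ colouring′ with m′ ≤? m
  ... | yes m′≤m = ⊥-elim (¬colouring (Colorable-≤ colouring′ m′≤m))
  ... | no m′≰m = ≰⇒> m′≰m

RemovedEdge? : (G : Graph n) (f : Fin n → Maybe (Fin n)) (x y : Fin n) → Dec (RemovedEdge G f x y)
RemovedEdge? G f x y =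
  Edge? G x y ×-dec ¬? (Maybe.≡-dec _≟_ (f x) (just y)) ×-dec ¬? (Maybe.≡-dec _≟_ (f y) (just x))

χ₁≤colours : (G : Graph n) {χ₁ m : ℕ} → χ₁≡ G χ₁ → (F : OneSelection G) → Colorable (RemovedEdge G (proj₁ F)) m → χ₁ ≤ m
χ₁≤colours G (_ , χ₁-least) F colouring =
  let (k , k≤m , χ-k) = chromatic-number-≤ _ (RemovedEdge? G (proj₁ F)) _ colouring in
  ≤-trans (χ₁-least F k χ-k) k≤m

χ₁≤χ : (G : Graph n) {χ χ₁ : ℕ} → χ≡ G χ → χ₁≡ G χ₁ → χ₁ ≤ χ
χ₁≤χ G ((c , proper) , _) χ₁-G = χ₁≤colours G χ₁-G ((λ _ → nothing) , λ _ _ ()) (c , λ x y (xy , _) → proper x y xy)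

-- Lower bounds: a proper colouring of G_f on a clique

Chosen : (Fin n → Maybe (Fin n)) → Fin n → Fin n → Set
Chosen f x y = f x ≡ just y ⊎ f y ≡ just x

PairwiseChosen : (Fin n → Maybe (Fin n)) → List (Fin n) → Set
PairwiseChosen f C = ∀ {x y} → x ∈ C → y ∈ C → x ≢ y → Chosen f x y

module _ (f : Fin n → Maybe (Fin n)) where

  selection-functional : ∀ {x y z} → f x ≡ just y → f x ≡ just z → y ≡ z
  selection-functional fx≡y fx≡z = Maybe.just-injective (trans (sym fx≡y) fx≡z)

  chosen-triangle-external : ∀ {a b c} → a ≢ b → a ≢ c → b ≢ c → f a ≢ just b → f a ≢ just c →
    Chosen f a b → Chosen f a c → Chosen f b c → ⊥
  chosen-triangle-external a≢b a≢c b≢c fa≢b fa≢c ab ac bc with ab | ac | bc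
  ... | inj₁ fa≡b | _ | _ = fa≢b fa≡b
  ... | inj₂ _ | inj₁ fa≡c | _ = fa≢c fa≡c
  ... | inj₂ fb≡a | inj₂ fc≡a | inj₁ fb≡c = a≢c (selection-functional fb≡a fb≡c)
  ... | inj₂ fb≡a | inj₂ fc≡a | inj₂ fc≡b = a≢b (selection-functional fc≡a fc≡b)

  -- a selects at most one of b, c, d, hence neither of the other two, which form a triangle with a.
  no-chosen-K₄ : ∀ {a b c d} → a ≢ b → a ≢ c → a ≢ d → b ≢ c → b ≢ d → c ≢ d →
    Chosen f a b → Chosen f a c → Chosen f a d → Chosen f b c → Chosen f b d → Chosen f c d → ⊥
  no-chosen-K₄ {a} {b} {c} {d} a≢b a≢c a≢d b≢c b≢d c≢d ab ac ad bc bd cd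
    with Maybe.≡-dec _≟_ (f a) (just b) | Maybe.≡-dec _≟_ (f a) (just c)
  ... | yes fa≡b | _ = chosen-triangle-external a≢c a≢d c≢d
          (b≢c ∘ selection-functional fa≡b) (b≢d ∘ selection-functional fa≡b) ac ad cd
  ... | no _ | yes fa≡c = chosen-triangle-external a≢b a≢d b≢d
          (λ fa≡b → b≢c (selection-functional fa≡b fa≡c)) (c≢d ∘ selection-functional fa≡c) ab ad bd
  ... | no fa≢b | no fa≢c = chosen-triangle-external a≢b a≢c b≢c fa≢b fa≢c ab ac bc

  External : List (Fin n) → Fin n → Set
  External C x = ∀ {y} → y ∈ C → f x ≢ just y

  chosen-class-weight≤3 : (e : Fin n → ℕ) (C : List (Fin n)) → Unique C → PairwiseChosen f C →
    (∀ {x} → x ∈ C → e x ≡ 0 ⊎ e x ≡ 1 × External C x) → sum (map (suc ∘ e) C) ≤ 3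
  chosen-class-weight≤3 e [] _ _ _ = z≤n
  chosen-class-weight≤3 e (a ∷ []) _ _ e-ok with e-ok (here refl)
  ... | inj₁ ea≡0 rewrite ea≡0 = s≤s z≤n
  ... | inj₂ (ea≡1 , _) rewrite ea≡1 = s≤s (s≤s z≤n)
  chosen-class-weight≤3 e (a ∷ b ∷ []) ((a≢b ∷ []) ∷ _) chosen e-ok with e-ok ∈₁ | e-ok ∈₂
  ... | inj₁ ea≡0 | inj₁ eb≡0 rewrite ea≡0 | eb≡0 = s≤s (s≤s z≤n)
  ... | inj₁ ea≡0 | inj₂ (eb≡1 , _) rewrite ea≡0 | eb≡1 = ≤-refl
  ... | inj₂ (ea≡1 , _) | inj₁ eb≡0 rewrite ea≡1 | eb≡0 = ≤-refl
  ... | inj₂ (_ , a-ext) | inj₂ (_ , b-ext) with chosen ∈₁ ∈₂ a≢b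
  ...   | inj₁ fa≡b = ⊥-elim (a-ext ∈₂ fa≡b)
  ...   | inj₂ fb≡a = ⊥-elim (b-ext ∈₁ fb≡a)
  chosen-class-weight≤3 e (a ∷ b ∷ c ∷ []) ((a≢b ∷ a≢c ∷ []) ∷ (b≢c ∷ []) ∷ _) chosen e-ok
    with e-ok ∈₁ | e-ok ∈₂ | e-ok ∈₃
  ... | inj₁ ea≡0 | inj₁ eb≡0 | inj₁ ec≡0 rewrite ea≡0 | eb≡0 | ec≡0 = ≤-refl
  ... | inj₂ (_ , a-ext) | _ | _ = ⊥-elim (chosen-triangle-external a≢b a≢c b≢c (a-ext ∈₂) (a-ext ∈₃)
          (chosen ∈₁ ∈₂ a≢b) (chosen ∈₁ ∈₃ a≢c) (chosen ∈₂ ∈₃ b≢c))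
  ... | _ | inj₂ (_ , b-ext) | _ = ⊥-elim (chosen-triangle-external (≢-sym a≢b) b≢c a≢c (b-ext ∈₁) (b-ext ∈₃)
          (chosen ∈₂ ∈₁ (≢-sym a≢b)) (chosen ∈₂ ∈₃ b≢c) (chosen ∈₁ ∈₃ a≢c))
  ... | _ | _ | inj₂ (_ , c-ext) = ⊥-elim (chosen-triangle-external (≢-sym a≢c) (≢-sym b≢c) a≢b (c-ext ∈₁) (c-ext ∈₂)
          (chosen ∈₃ ∈₁ (≢-sym a≢c)) (chosen ∈₃ ∈₂ (≢-sym b≢c)) (chosen ∈₁ ∈₂ a≢b))
  chosen-class-weight≤3 e (a ∷ b ∷ c ∷ d ∷ _) ((a≢b ∷ a≢c ∷ a≢d ∷ _) ∷ (b≢c ∷ b≢d ∷ _) ∷ (c≢d ∷ _) ∷ _) chosen _ =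
    ⊥-elim (no-chosen-K₄ a≢b a≢c a≢d b≢c b≢d c≢d
      (chosen ∈₁ ∈₂ a≢b) (chosen ∈₁ ∈₃ a≢c) (chosen ∈₁ ∈₄ a≢d) (chosen ∈₂ ∈₃ b≢c) (chosen ∈₂ ∈₄ b≢d) (chosen ∈₃ ∈₄ c≢d))

module SelectionOnClique (G : Graph n) {f : Fin n → Maybe (Fin n)} {c : Fin n → Fin k}
  (proper : ∀ x y → RemovedEdge G f x y → c x ≢ c y) {L : List (Fin n)} (L-clique : IsCliqueList G L) where

  same-colour⇒chosen : ∀ {x y} → x ∈ L → y ∈ L → x ≢ y → c x ≡ c y → Chosen f x y
  same-colour⇒chosen {x} {y} x∈L y∈L x≢y cx≡cy
    with Maybe.≡-dec _≟_ (f x) (just y) | Maybe.≡-dec _≟_ (f y) (just x)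
  ... | yes fx≡y | _ = inj₁ fx≡y
  ... | no _ | yes fy≡x = inj₂ fy≡x
  ... | no fx≢y | no fy≢x = ⊥-elim (proper x y (adjacent L-clique x∈L y∈L x≢y , fx≢y , fy≢x) cx≡cy)

  Internal : Fin n → Set
  Internal x = ∃ λ y → f x ≡ just y × y ∈ L × c y ≡ c x

  Internal? : ∀ x → Dec (Internal x)
  Internal? x with f x
  ... | nothing = no λ { (_ , () , _) }
  ... | just y with y ∈? L | c y ≟ c x
  ...   | yes y∈L | yes cy≡cx = yes (y , refl , y∈L , cy≡cx)
  ...   | no y∉L | _ = no λ { (_ , refl , y∈L , _) → y∉L y∈L }
  ...   | yes _ | no cy≢cx = no λ { (_ , refl , _ , cy≡cx) → cy≢cx cy≡cx }

  excess : Fin n → ℕ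
  excess x = if does (Internal? x) then 0 else 1

  excess-external : ∀ {x} → ¬ Internal x → excess x ≡ 1
  excess-external {x} ¬int rewrite dec-false (Internal? x) ¬int = refl

  class-weight≤3 : ∀ j → sum (map (suc ∘ excess) (colourClass c j L)) ≤ 3
  class-weight≤3 j = chosen-class-weight≤3 f excess C (colourClass-unique c j L (distinct L-clique)) C-chosen excess-ok
    where
    C = colourClass c j L
    in-L : ∀ {x} → x ∈ C → x ∈ L
    in-L = proj₁ ∘ ∈-colourClass⁻ c j L
    same-colour : ∀ {x y} → x ∈ C → y ∈ C → c x ≡ c y
    same-colour x∈ y∈ = trans (proj₂ (∈-colourClass⁻ c j L x∈)) (sym (proj₂ (∈-colourClass⁻ c j L y∈)))
    C-chosen : PairwiseChosen f C
    C-chosen x∈ y∈ x≢y = same-colour⇒chosen (in-L x∈) (in-L y∈) x≢y (same-colour x∈ y∈)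
    excess-ok : ∀ {x} → x ∈ C → excess x ≡ 0 ⊎ excess x ≡ 1 × External f C x
    excess-ok {x} x∈ with Internal? x
    ... | yes _ = inj₁ refl
    ... | no ¬int = inj₂ (refl , λ y∈ fx≡y → ¬int (_ , fx≡y , in-L y∈ , same-colour y∈ x∈))

  length+excess≤ : length L + sum (map excess L) ≤ k * 3
  length+excess≤ = subst (_≤ k * 3) (sum-map-suc excess L) (sum≤-colourClasses c (suc ∘ excess) 3 L class-weight≤3)

  length≤ : length L ≤ k * 3
  length≤ = ≤-trans (m≤m+n _ _) length+excess≤

  tight⇒internal : length L ≡ k * 3 → ∀ {x} → x ∈ L → Internal x
  tight⇒internal tight {x} x∈L with Internal? x
  ... | yes int = int
  ... | no ¬int = contradiction tight (<⇒≢ (begin-strict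
    length L                      <⟨ m<m+n (length L) (subst (_≤ _) (excess-external ¬int) (sum-map-∈ excess x∈L)) ⟩
    length L + sum (map excess L) ≤⟨ length+excess≤ ⟩
    k * 3                         ∎))
    where open ≤-Reasoning

  near-tight⇒external-unique : suc (length L) ≡ k * 3 → ∀ {x y} → x ∈ L → y ∈ L → ¬ Internal x → ¬ Internal y → x ≡ y
  near-tight⇒external-unique near-tight {x} {y} x∈L y∈L ¬int-x ¬int-y with x ≟ y
  ... | yes x≡y = x≡y
  ... | no x≢y = contradiction near-tight (<⇒≢ (begin-strict
    suc (length L)                ≡⟨ +-comm 1 (length L) ⟩
    length L + 1                  <⟨ +-monoʳ-< (length L) two≤excess ⟩
    length L + sum (map excess L) ≤⟨ length+excess≤ ⟩
    k * 3                         ∎))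
    where
    open ≤-Reasoning
    two≤excess : 2 ≤ sum (map excess L)
    two≤excess = subst (_≤ sum (map excess L)) (cong₂ _+_ (excess-external ¬int-x) (excess-external ¬int-y))
      (sum-map-∈₂ excess (distinct L-clique) x∈L y∈L x≢y)

clique≤3χ₁ : (G : Graph n) {χ₁ : ℕ} → χ₁≡ G χ₁ → {L : List (Fin n)} → IsCliqueList G L → length L ≤ χ₁ * 3
clique≤3χ₁ G (((_ , _) , (_ , proper) , _) , _) L-clique = SelectionOnClique.length≤ G proper L-clique

module TightCliques (G : Graph n) {f : Fin n → Maybe (Fin n)} (f-valid : ∀ v u → f v ≡ just u → Edge G v u)
  {c : Fin n → Fin k} (proper : ∀ x y → RemovedEdge G f x y → c x ≢ c y) where

  no-loop : ∀ x → f x ≢ just x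
  no-loop x fx≡x = Edge⇒≢ G (f-valid x x fx≡x) refl

  module _ {A A′ : List (Fin n)} (A-clique : IsCliqueList G A) (A′-clique : IsCliqueList G A′) where
    private
      module S = SelectionOnClique G proper A-clique
      module S′ = SelectionOnClique G proper A′-clique

    -- Following the selections x → y → z inside both cliques, the edge {z, x} of A cannot be chosen.
    no-exchange : length A ≡ k * 3 → length A′ ≡ k * 3 →
      ∀ {x} → x ∈ A → x ∉ A′ → (∀ {y} → y ∈ A → y ≢ x → y ∈ A′) → ⊥
    no-exchange A-tight A′-tight {x} x∈A x∉A′ A∖x⊆A′ with S.tight⇒internal A-tight x∈A
    ... | y , fx≡y , y∈A , cy≡cx
      with S′.tight⇒internal A′-tight (A∖x⊆A′ y∈A λ { refl → no-loop x fx≡y }) | S.tight⇒internal A-tight y∈A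
    ... | z , fy≡z , z∈A′ , cz≡cy | z′ , fy≡z′ , z′∈A , _
      with S.same-colour⇒chosen (subst (_∈ A) (selection-functional f fy≡z′ fy≡z) z′∈A) x∈A
             (λ { refl → x∉A′ z∈A′ }) (trans cz≡cy cy≡cx)
    ... | inj₁ fz≡x = let (w , fz≡w , w∈A′ , _) = S′.tight⇒internal A′-tight z∈A′ in
                      x∉A′ (subst (_∈ A′) (selection-functional f fz≡w fz≡x) w∈A′)
    ... | inj₂ fx≡z = no-loop y (subst (λ t → f y ≡ just t) (sym (selection-functional f fx≡y fx≡z)) fy≡z)

  module _ {K : List (Fin n)} (K-clique : IsCliqueList G K) (near-tight : suc (length K) ≡ k * 3)
    (twin : Fin n → Fin n) (twin∉K : ∀ {x} → x ∈ K → twin x ∉ K)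
    (twin-clique : ∀ {x} → x ∈ K → IsCliqueList G (twin x ∷ remove x K))
    (twin-injective : ∀ {x y} → x ∈ K → y ∈ K → twin x ≡ twin y → x ≡ y) where
    private
      module SK = SelectionOnClique G proper K-clique

      module Twin {x : Fin n} (x∈K : x ∈ K) where
        Kx : List (Fin n)
        Kx = twin x ∷ remove x K

        module Sx = SelectionOnClique G proper (twin-clique x∈K)

        Kx-near-tight : suc (length Kx) ≡ k * 3
        Kx-near-tight = trans (cong suc (length-remove (distinct K-clique) x∈K)) near-tight

        ≢twin : ∀ {a} → a ∈ K → a ≢ twin x
        ≢twin a∈K refl = twin∉K x∈K a∈K

        ∈Kx : ∀ {a} → a ∈ K → a ≢ x → a ∈ Kx
        ∈Kx a∈K a≢x = there (∈-remove⁺ a∈K a≢x)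

        ∈K : ∀ {a} → a ∈ Kx → a ≢ twin x → a ∈ K
        ∈K (here refl) a≢twin = ⊥-elim (a≢twin refl)
        ∈K (there a∈) _ = proj₁ (∈-remove⁻ a∈)

        internal-but : ∀ {w a} → w ∈ K → w ≢ x → f w ≡ just x → a ∈ Kx → a ≢ w → Sx.Internal a
        internal-but {w} {a} w∈K w≢x fw≡x a∈Kx a≢w with Sx.Internal? a
        ... | yes int = int
        ... | no ¬int = ⊥-elim (a≢w (Sx.near-tight⇒external-unique Kx-near-tight a∈Kx (∈Kx w∈K w≢x) ¬int w-external))
          where
          w-external : ¬ Sx.Internal w
          w-external (t , fw≡t , t∈Kx , _) with subst (_∈ Kx) (selection-functional f fw≡t fw≡x) t∈Kx
          ... | here x≡twin = twin∉K x∈K (subst (_∈ K) x≡twin x∈K)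
          ... | there x∈ = ∉-remove x K x∈

        selects-twin : ∀ {w u} → w ∈ K → u ∈ K → w ≢ x → u ≢ x → w ≢ u → c w ≡ c x → c u ≡ c x →
          f w ≡ just x → ∃ λ t → t ∈ K × f t ≡ just (twin x)
        selects-twin {w} {u} w∈K u∈K w≢x u≢x w≢u cw≡cx cu≡cx fw≡x
          with internal-but w∈K w≢x fw≡x (here refl) (≢-sym (≢twin w∈K))
        ... | a , ftwin≡a , a∈Kx , ca≡ctwin with a ≟ w
        ...   | yes refl with Sx.same-colour⇒chosen (∈Kx u∈K u≢x) (here refl) (≢twin u∈K)
                                (trans cu≡cx (trans (sym cw≡cx) ca≡ctwin))
        ...     | inj₁ fu≡twin = u , u∈K , fu≡twin
        ...     | inj₂ ftwin≡u = ⊥-elim (w≢u (selection-functional f ftwin≡a ftwin≡u))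
        selects-twin w∈K u∈K w≢x u≢x w≢u cw≡cx cu≡cx fw≡x
          | a , ftwin≡a , a∈Kx , ca≡ctwin | no a≢w with internal-but w∈K w≢x fw≡x a∈Kx a≢w
        ... | d , fa≡d , d∈Kx , cd≡ca with d ≟ twin x
        ...   | yes refl = a , ∈K a∈Kx (λ { refl → no-loop a ftwin≡a }) , fa≡d
        ...   | no d≢twin with Sx.same-colour⇒chosen d∈Kx (here refl) d≢twin (trans cd≡ca ca≡ctwin)
        ...     | inj₁ fd≡twin = d , ∈K d∈Kx d≢twin , fd≡twin
        ...     | inj₂ ftwin≡d = ⊥-elim (no-loop a
                    (subst (λ t → f a ≡ just t) (sym (selection-functional f ftwin≡a ftwin≡d)) fa≡d))

    twin-selected : ∀ {x y z} → x ∈ K → y ∈ K → z ∈ K → x ≢ y → x ≢ z → y ≢ z → c x ≡ c y → c x ≡ c z →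
      ∃ λ t → t ∈ K × f t ≡ just (twin x)
    twin-selected x∈K y∈K z∈K x≢y x≢z y≢z cx≡cy cx≡cz with SK.same-colour⇒chosen x∈K y∈K x≢y cx≡cy
    ... | inj₂ fy≡x = Twin.selects-twin x∈K y∈K z∈K (≢-sym x≢y) (≢-sym x≢z) y≢z (sym cx≡cy) (sym cx≡cz) fy≡x
    ... | inj₁ fx≡y with SK.same-colour⇒chosen x∈K z∈K x≢z cx≡cz
    ...   | inj₁ fx≡z = ⊥-elim (y≢z (selection-functional f fx≡y fx≡z))
    ...   | inj₂ fz≡x = Twin.selects-twin x∈K z∈K y∈K (≢-sym x≢z) (≢-sym x≢y) (≢-sym y≢z) (sym cx≡cz) (sym cx≡cy) fz≡x

    no-monochromatic-triple : ∀ {x y z} → x ∈ K → y ∈ K → z ∈ K → x ≢ y → x ≢ z → y ≢ z →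
      c x ≡ c y → c x ≡ c z → ⊥
    no-monochromatic-triple {x} {y} x∈K y∈K z∈K x≢y x≢z y≢z cx≡cy cx≡cz
      with twin-selected x∈K y∈K z∈K x≢y x≢z y≢z cx≡cy cx≡cz
         | twin-selected y∈K x∈K z∈K (≢-sym x≢y) y≢z x≢z (sym cx≡cy) (trans (sym cx≡cy) cx≡cz)
    ... | t₁ , t₁∈K , ft₁ | t₂ , t₂∈K , ft₂ =
      t₁≢t₂ (SK.near-tight⇒external-unique near-tight t₁∈K t₂∈K (external x∈K ft₁) (external y∈K ft₂))
      where
      external : ∀ {t x} → x ∈ K → f t ≡ just (twin x) → ¬ SK.Internal t
      external x∈K ft≡twin (s , ft≡s , s∈K , _) = twin∉K x∈K (subst (_∈ K) (selection-functional f ft≡s ft≡twin) s∈K)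
      t₁≢t₂ : t₁ ≢ t₂
      t₁≢t₂ refl = x≢y (twin-injective x∈K y∈K (selection-functional f ft₁ ft₂))

-- Upper bounds: selections built from cyclically oriented groups

data Group (n : ℕ) : Set where
  triangle : Fin n → Fin n → Fin n → Group n
  pair     : Fin n → Fin n → Group n
  single   : Fin n → Group n

members : Group n → List (Fin n)
members (triangle a b c) = a ∷ b ∷ c ∷ []
members (pair a b)       = a ∷ b ∷ []
members (single a)       = a ∷ []

cyclic : Group n → Fin n → Maybe (Fin n)
cyclic (triangle a b c) x =
  if does (x ≟ a) then just b else if does (x ≟ b) then just c else if does (x ≟ c) then just a else nothing
cyclic (pair a b) x = if does (x ≟ a) then just b else if does (x ≟ b) then just a else nothing
cyclic (single _) _ = nothing

cyclic-selects-member : (g : Group n) → Unique (members g) → ∀ {x y} → cyclic g x ≡ just y →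
  x ∈ members g × y ∈ members g × x ≢ y
cyclic-selects-member (triangle a b c) ((a≢b ∷ a≢c ∷ []) ∷ (b≢c ∷ []) ∷ _) {x} gx≡y
  with x ≟ a | x ≟ b | x ≟ c | gx≡y
... | yes refl | _ | _ | refl = ∈₁ , ∈₂ , a≢b
... | no _ | yes refl | _ | refl = ∈₂ , ∈₃ , b≢c
... | no _ | no _ | yes refl | refl = ∈₃ , ∈₁ , ≢-sym a≢c
cyclic-selects-member (pair a b) ((a≢b ∷ []) ∷ _) {x} gx≡y with x ≟ a | x ≟ b | gx≡y
... | yes refl | _ | refl = ∈₁ , ∈₂ , a≢b
... | no _ | yes refl | refl = ∈₂ , ∈₁ , ≢-sym a≢b

cyclic-chosen : (g : Group n) → Unique (members g) → PairwiseChosen (cyclic g) (members g)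
cyclic-chosen (triangle a b c) ((a≢b ∷ a≢c ∷ []) ∷ (b≢c ∷ []) ∷ _) = chosen
  where
  sa : cyclic (triangle a b c) a ≡ just b
  sa rewrite dec-true (a ≟ a) refl = refl
  sb : cyclic (triangle a b c) b ≡ just c
  sb rewrite dec-false (b ≟ a) (≢-sym a≢b) | dec-true (b ≟ b) refl = refl
  sc : cyclic (triangle a b c) c ≡ just a
  sc rewrite dec-false (c ≟ a) (≢-sym a≢c) | dec-false (c ≟ b) (≢-sym b≢c) | dec-true (c ≟ c) refl = refl
  chosen : PairwiseChosen (cyclic (triangle a b c)) (a ∷ b ∷ c ∷ [])
  chosen ∈₁ ∈₂ _ = inj₁ sa
  chosen ∈₂ ∈₁ _ = inj₂ sa
  chosen ∈₂ ∈₃ _ = inj₁ sb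
  chosen ∈₃ ∈₂ _ = inj₂ sb
  chosen ∈₃ ∈₁ _ = inj₁ sc
  chosen ∈₁ ∈₃ _ = inj₂ sc
  chosen ∈₁ ∈₁ x≢x = ⊥-elim (x≢x refl)
  chosen ∈₂ ∈₂ x≢x = ⊥-elim (x≢x refl)
  chosen ∈₃ ∈₃ x≢x = ⊥-elim (x≢x refl)
cyclic-chosen (pair a b) ((a≢b ∷ []) ∷ _) = chosen
  where
  sa : cyclic (pair a b) a ≡ just b
  sa rewrite dec-true (a ≟ a) refl = refl
  sb : cyclic (pair a b) b ≡ just a
  sb rewrite dec-false (b ≟ a) (≢-sym a≢b) | dec-true (b ≟ b) refl = refl
  chosen : PairwiseChosen (cyclic (pair a b)) (a ∷ b ∷ [])
  chosen ∈₁ ∈₂ _ = inj₁ sa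
  chosen ∈₂ ∈₁ _ = inj₁ sb
  chosen ∈₁ ∈₁ x≢x = ⊥-elim (x≢x refl)
  chosen ∈₂ ∈₂ x≢x = ⊥-elim (x≢x refl)
cyclic-chosen (single a) _ ∈₁ ∈₁ x≢x = ⊥-elim (x≢x refl)

Outside : List (Group n) → Fin n → Set
Outside gs x = All (λ g → x ∉ members g) gs

groupSelection : List (Group n) → (Fin n → Maybe (Fin n)) → Fin n → Maybe (Fin n)
groupSelection [] base x = base x
groupSelection (g ∷ gs) base x = if does (x ∈? members g) then cyclic g x else groupSelection gs base x

groupColour : List (Group n) → Fin n → ℕ
groupColour [] _ = 0
groupColour (g ∷ gs) x = if does (x ∈? members g) then suc (length gs) else groupColour gs x

groupColour≤ : (gs : List (Group n)) (x : Fin n) → groupColour gs x ≤ length gs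
groupColour≤ [] x = z≤n
groupColour≤ (g ∷ gs) x with x ∈? members g
... | yes _ = ≤-refl
... | no _ = m≤n⇒m≤1+n (groupColour≤ gs x)

module _ (G : Graph n) where

  groupSelection-edge : ∀ gs → All (IsCliqueList G ∘ members) gs → ∀ {base} →
    (∀ {x y} → base x ≡ just y → Edge G x y) → ∀ {x y} → groupSelection gs base x ≡ just y → Edge G x y
  groupSelection-edge [] _ base-edge = base-edge
  groupSelection-edge (g ∷ gs) (g-clique ∷ gs-cliques) base-edge {x} sel with x ∈? members g
  ... | yes _ = let (x∈ , y∈ , x≢y) = cyclic-selects-member g (distinct g-clique) sel in adjacent g-clique x∈ y∈ x≢y
  ... | no _ = groupSelection-edge gs gs-cliques base-edge sel

  groupSelection-chosen : ∀ gs → All (IsCliqueList G ∘ members) gs → ∀ base {x y} → x ≢ y →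
    groupColour gs x ≡ groupColour gs y → (Outside gs x → Outside gs y → Chosen base x y) →
    Chosen (groupSelection gs base) x y
  groupSelection-chosen [] _ base x≢y _ base-chosen = base-chosen [] []
  groupSelection-chosen (g ∷ gs) (g-clique ∷ gs-cliques) base {x} {y} x≢y same-colour base-chosen
    with x ∈? members g | y ∈? members g
  ... | yes x∈ | yes y∈ = cyclic-chosen g (distinct g-clique) x∈ y∈ x≢y
  ... | yes _ | no _ = ⊥-elim (<-irrefl (sym same-colour) (s≤s (groupColour≤ gs y)))
  ... | no _ | yes _ = ⊥-elim (<-irrefl same-colour (s≤s (groupColour≤ gs x)))
  ... | no x∉ | no y∉ = groupSelection-chosen gs gs-cliques base x≢y same-colour
                          λ x-out y-out → base-chosen (x∉ ∷ x-out) (y∉ ∷ y-out)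

  group-colouring : ∀ gs → All (IsCliqueList G ∘ members) gs → ∀ base → (∀ {x y} → base x ≡ just y → Edge G x y) →
    (∀ {x y} → Outside gs x → Outside gs y → Edge G x y → Chosen base x y) →
    Σ (OneSelection G) λ F → Colorable (RemovedEdge G (proj₁ F)) (suc (length gs))
  group-colouring gs gs-cliques base base-edge base-chosen =
    (groupSelection gs base , λ _ _ → groupSelection-edge gs gs-cliques base-edge) , colour , proper
    where
    colour : Fin n → Fin (suc (length gs))
    colour x = fromℕ< (s≤s (groupColour≤ gs x))
    proper : ∀ x y → RemovedEdge G (groupSelection gs base) x y → colour x ≢ colour y
    proper x y (xy , fx≢y , fy≢x) cx≡cy
      with groupSelection-chosen gs gs-cliques base (Edge⇒≢ G xy) (fromℕ<-injective _ _ _ _ cx≡cy)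
             (λ x-out y-out → base-chosen x-out y-out xy)
    ... | inj₁ fx≡y = fx≢y fx≡y
    ... | inj₂ fy≡x = fy≢x fy≡x

triples : List (Fin n) → List (Group n)
triples (a ∷ b ∷ c ∷ R) = triangle a b c ∷ triples R
triples (a ∷ b ∷ [])    = pair a b ∷ []
triples (a ∷ [])        = single a ∷ []
triples []              = []

length-triples : (R : List (Fin n)) → length (triples R) ≡ ⌈ length R /3⌉
length-triples (a ∷ b ∷ c ∷ R) = trans (cong suc (length-triples R))
  (sym (m/n≡1+[m∸n]/n {3 + length R + 2} {3} (s≤s (s≤s (s≤s z≤n)))))
length-triples (a ∷ b ∷ []) = refl
length-triples (a ∷ []) = refl
length-triples [] = refl

triples-cliques : (G : Graph n) {R : List (Fin n)} → IsCliqueList G R → All (IsCliqueList G ∘ members) (triples R)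
triples-cliques G {a ∷ b ∷ c ∷ R} R-clique with distinct R-clique
... | (a≢b ∷ a≢c ∷ _) ∷ (b≢c ∷ _) ∷ (_ ∷ uR) =
  ⊆-clique R-clique ((a≢b ∷ a≢c ∷ []) ∷ (b≢c ∷ []) ∷ [] ∷ []) (λ { ∈₁ → ∈₁ ; ∈₂ → ∈₂ ; ∈₃ → ∈₃ })
  ∷ triples-cliques G (⊆-clique R-clique uR (there ∘ there ∘ there))
triples-cliques G {a ∷ b ∷ []} R-clique = R-clique ∷ []
triples-cliques G {a ∷ []} R-clique = R-clique ∷ []
triples-cliques G {[]} R-clique = []

triples-cover : {R : List (Fin n)} {x : Fin n} → x ∈ R → ¬ Outside (triples R) x
triples-cover {R = a ∷ b ∷ c ∷ R} ∈₁ (x∉abc ∷ _) = x∉abc ∈₁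
triples-cover {R = a ∷ b ∷ c ∷ R} ∈₂ (x∉abc ∷ _) = x∉abc ∈₂
triples-cover {R = a ∷ b ∷ c ∷ R} ∈₃ (x∉abc ∷ _) = x∉abc ∈₃
triples-cover {R = a ∷ b ∷ c ∷ R} (there (there (there x∈R))) (_ ∷ x-out) = triples-cover x∈R x-out
triples-cover {R = a ∷ b ∷ []} x∈ab (x∉ab ∷ _) = x∉ab x∈ab
triples-cover {R = a ∷ []} x∈a (x∉a ∷ _) = x∉a x∈a

-- Colour classes: the triples of Q ∖ B, and B together with all vertices outside Q; an outside vertex
-- selects its edge to the hub, its only possible neighbour in B.

module HubColouring (G : Graph n) {Q : List (Fin n)} (Q-clique : IsCliqueList G Q)
  (outside-independent : ∀ {x y} → x ∉ Q → y ∉ Q → ¬ Edge G x y)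
  (B : Group n) (B-distinct : Unique (members B)) (B⊆Q : members B ⊆ Q)
  (hub : Fin n) (hub-only : ∀ {v b} → v ∉ Q → b ∈ members B → Edge G v b → b ≡ hub) where

  R : List (Fin n)
  R = filter (λ x → ¬? (x ∈? members B)) Q

  B-clique : IsCliqueList G (members B)
  B-clique = ⊆-clique Q-clique B-distinct B⊆Q

  R-clique : IsCliqueList G R
  R-clique = ⊆-clique Q-clique (Unique.filter⁺ _ (distinct Q-clique)) (proj₁ ∘ ∈-filter⁻ (λ x → ¬? (x ∈? members B)))

  base : Fin n → Maybe (Fin n)
  base x with x ∈? Q | Edge? G x hub
  ... | yes _ | _ = cyclic B x
  ... | no _ | yes _ = just hub
  ... | no _ | no _ = nothing

  base-edge : ∀ {x y} → base x ≡ just y → Edge G x y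
  base-edge {x} bx≡y with x ∈? Q | Edge? G x hub
  ... | yes _ | _ = let (x∈ , y∈ , x≢y) = cyclic-selects-member B B-distinct bx≡y in adjacent B-clique x∈ y∈ x≢y
  base-edge refl | no _ | yes x~hub = x~hub

  base-inside : ∀ {x} → x ∈ Q → base x ≡ cyclic B x
  base-inside {x} x∈Q with x ∈? Q
  ... | yes _ = refl
  ... | no x∉Q = ⊥-elim (x∉Q x∈Q)

  base-outside : ∀ {v} → v ∉ Q → Edge G v hub → base v ≡ just hub
  base-outside {v} v∉Q v~hub with v ∈? Q | Edge? G v hub
  ... | yes v∈Q | _ = ⊥-elim (v∉Q v∈Q)
  ... | no _ | yes _ = refl
  ... | no _ | no ¬v~hub = ⊥-elim (¬v~hub v~hub)

  outside-triples : ∀ {x} → Outside (triples R) x → x ∈ members B ⊎ x ∉ Q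
  outside-triples {x} x-out with x ∈? members B | x ∈? Q
  ... | yes x∈B | _ = inj₁ x∈B
  ... | no _ | no x∉Q = inj₂ x∉Q
  ... | no x∉B | yes x∈Q = ⊥-elim (triples-cover (∈-filter⁺ (λ x → ¬? (x ∈? members B)) x∈Q x∉B) x-out)

  base-chosen : ∀ {x y} → Outside (triples R) x → Outside (triples R) y → Edge G x y → Chosen base x y
  base-chosen {x} {y} x-out y-out xy with outside-triples x-out | outside-triples y-out
  ... | inj₁ x∈B | inj₁ y∈B rewrite base-inside (B⊆Q x∈B) | base-inside (B⊆Q y∈B) =
    cyclic-chosen B B-distinct x∈B y∈B (Edge⇒≢ G xy)
  ... | inj₁ x∈B | inj₂ y∉Q with hub-only y∉Q x∈B (Edge-sym G xy)
  ...   | refl = inj₂ (base-outside y∉Q (Edge-sym G xy))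
  base-chosen {x} {y} x-out y-out xy | inj₂ x∉Q | inj₁ y∈B with hub-only x∉Q y∈B xy
  ...   | refl = inj₁ (base-outside x∉Q xy)
  base-chosen {x} {y} x-out y-out xy | inj₂ x∉Q | inj₂ y∉Q = ⊥-elim (outside-independent x∉Q y∉Q xy)

  hub-colouring : Σ (OneSelection G) λ F → Colorable (RemovedEdge G (proj₁ F)) (suc ⌈ length Q ∸ length (members B) /3⌉)
  hub-colouring =
    let (F , colouring) = group-colouring G (triples R) (triples-cliques G R-clique) base base-edge base-chosen
    in F , Colorable-≤ colouring (≤-reflexive (cong suc (trans (length-triples R)
             (cong ⌈_/3⌉ (length-without B-distinct (distinct Q-clique) B⊆Q)))))

toList : Subset n → List (Fin n)
toList Vec.[] = []
toList (true Vec.∷ p) = zero ∷ map suc (toList p)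
toList (false Vec.∷ p) = map suc (toList p)

length-toList : (p : Subset n) → length (toList p) ≡ ∣ p ∣
length-toList Vec.[] = refl
length-toList (true Vec.∷ p) = cong suc (trans (length-map suc (toList p)) (length-toList p))
length-toList (false Vec.∷ p) = trans (length-map suc (toList p)) (length-toList p)

∈-toList⁻ : (p : Subset n) {x : Fin n} → x ∈ toList p → x ∈ₛ p
∈-toList⁻ (true Vec.∷ p) (here refl) = Vec.here
∈-toList⁻ (true Vec.∷ p) (there x∈) with ∈-map⁻ suc x∈
... | _ , y∈ , refl = Vec.there (∈-toList⁻ p y∈)
∈-toList⁻ (false Vec.∷ p) x∈ with ∈-map⁻ suc x∈
... | _ , y∈ , refl = Vec.there (∈-toList⁻ p y∈)

∈-toList⁺ : (p : Subset n) {x : Fin n} → x ∈ₛ p → x ∈ toList p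
∈-toList⁺ (true Vec.∷ p) Vec.here = here refl
∈-toList⁺ (true Vec.∷ p) (Vec.there x∈) = there (∈-map⁺ suc (∈-toList⁺ p x∈))
∈-toList⁺ (false Vec.∷ p) (Vec.there x∈) = ∈-map⁺ suc (∈-toList⁺ p x∈)

toList-unique : (p : Subset n) → Unique (toList p)
toList-unique Vec.[] = []
toList-unique (true Vec.∷ p) = zero∉ (toList p) ∷ Unique.map⁺ fsuc-injective (toList-unique p)
  where
  zero∉ : (L : List (Fin n)) → All (Fin.zero ≢_) (map Fin.suc L)
  zero∉ [] = []
  zero∉ (_ ∷ L) = (λ ()) ∷ zero∉ L
toList-unique (false Vec.∷ p) = Unique.map⁺ fsuc-injective (toList-unique p)

fromList : List (Fin n) → Subset n
fromList L = Vec.tabulate λ i → does (i ∈? L)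

∈-fromList⁻ : (L : List (Fin n)) {x : Fin n} → x ∈ₛ fromList L → x ∈ L
∈-fromList⁻ L {x} x∈ with x ∈? L | trans (sym (lookup∘tabulate (λ i → does (i ∈? L)) x)) ([]=⇒lookup x∈)
... | yes x∈L | _ = x∈L

∈-fromList⁺ : (L : List (Fin n)) {x : Fin n} → x ∈ L → x ∈ₛ fromList L
∈-fromList⁺ L {x} x∈L = lookup⇒[]= x (fromList L)
  (trans (lookup∘tabulate (λ i → does (i ∈? L)) x) (dec-true (x ∈? L) x∈L))

∣fromList∣ : {L : List (Fin n)} → Unique L → ∣ fromList L ∣ ≡ length L
∣fromList∣ {L = L} uL = trans (sym (length-toList p)) (≤-antisym
  (⊆-length (toList-unique p) uL (∈-fromList⁻ L ∘ ∈-toList⁻ p))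
  (⊆-length uL (toList-unique p) (∈-toList⁺ p ∘ ∈-fromList⁺ L)))
  where p = fromList L

clique-toList : (G : Graph n) {S : Subset n} → IsClique G S → IsCliqueList G (toList S)
clique-toList G {S} S-clique = record
  { distinct = toList-unique S
  ; adjacent = λ x∈ y∈ → S-clique _ _ (∈-toList⁻ S x∈) (∈-toList⁻ S y∈)
  }

clique-fromList : (G : Graph n) {L : List (Fin n)} → IsCliqueList G L → IsClique G (fromList L)
clique-fromList G {L} L-clique x y x∈ y∈ = adjacent L-clique (∈-fromList⁻ L x∈) (∈-fromList⁻ L y∈)

module _ (G : Graph n) {χ : ℕ} (χ-G : χ≡ G χ) where

  clique≤χ : {S : Subset n} → IsClique G S → ∣ S ∣ ≤ χ
  clique≤χ {S} S-clique = subst (_≤ χ) (length-toList S) (clique≤colours G (proj₁ χ-G) (clique-toList G S-clique))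

  ω-unique-⊆ : ωUnique G → {L₁ L₂ : List (Fin n)} → IsCliqueList G L₁ → IsCliqueList G L₂ →
    length L₁ ≡ χ → length L₂ ≡ χ → L₁ ⊆ L₂
  ω-unique-⊆ (w , (_ , ω-bound) , S , S-clique , ∣S∣≡w , only-S) {L₁} {L₂} L₁-clique L₂-clique |L₁|≡χ |L₂|≡χ x∈L₁ =
    ∈-fromList⁻ L₂ (subst (_ ∈ₛ_) (trans (is-S L₁-clique |L₁|≡χ) (sym (is-S L₂-clique |L₂|≡χ))) (∈-fromList⁺ L₁ x∈L₁))
    where
    size : ∀ {L} → IsCliqueList G L → length L ≡ χ → ∣ fromList L ∣ ≡ χ
    size L-clique |L|≡χ = trans (∣fromList∣ (distinct L-clique)) |L|≡χ
    w≡χ : w ≡ χ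
    w≡χ = ≤-antisym (subst (_≤ χ) ∣S∣≡w (clique≤χ S-clique))
                    (subst (_≤ w) (size L₁-clique |L₁|≡χ) (ω-bound _ (clique-fromList G L₁-clique)))
    is-S : ∀ {L} → IsCliqueList G L → length L ≡ χ → fromList L ≡ S
    is-S L-clique |L|≡χ = only-S _ (clique-fromList G L-clique) (trans (size L-clique |L|≡χ) (sym w≡χ))

  ω-unique-if : {Q : List (Fin n)} → IsCliqueList G Q → length Q ≡ χ →
    (∀ {T} → IsClique G T → ∣ T ∣ ≡ χ → toList T ⊆ Q) → ωUnique G
  ω-unique-if {Q} Q-clique |Q|≡χ maximum⊆Q =
    χ , ((fromList Q , clique-fromList G Q-clique , ∣Q∣≡χ) , λ _ → clique≤χ) ,
    fromList Q , clique-fromList G Q-clique , ∣Q∣≡χ , only-Q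
    where
    ∣Q∣≡χ : ∣ fromList Q ∣ ≡ χ
    ∣Q∣≡χ = trans (∣fromList∣ (distinct Q-clique)) |Q|≡χ
    only-Q : ∀ T → IsClique G T → ∣ T ∣ ≡ χ → T ≡ fromList Q
    only-Q T T-clique ∣T∣≡χ = ⊆-antisym
      (λ x∈T → ∈-fromList⁺ Q (T⊆Q (∈-toList⁺ T x∈T)))
      (λ x∈Q → ∈-toList⁻ T (⊆-length⇒⊇ (toList-unique T) (distinct Q-clique) T⊆Q
                 (≤-reflexive (trans |Q|≡χ (sym (trans (length-toList T) ∣T∣≡χ)))) (∈-fromList⁻ Q x∈Q)))
      where
      T⊆Q = maximum⊆Q T-clique ∣T∣≡χ

data Residue3 : ℕ → Set where
  mul3   : ∀ q → Residue3 (q * 3)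
  mul3+1 : ∀ q → Residue3 (1 + q * 3)
  mul3+2 : ∀ q → Residue3 (2 + q * 3)

residue3 : ∀ m → Residue3 m
residue3 zero = mul3 0
residue3 (suc m) with residue3 m
... | mul3 q = mul3+1 q
... | mul3+1 q = mul3+2 q
... | mul3+2 q = mul3 (suc q)

[m+q*3]/3 : ∀ m q → (m + q * 3) / 3 ≡ m / 3 + q
[m+q*3]/3 m q = trans (+-distrib-/-∣ʳ m (n∣m*n q)) (cong (m / 3 +_) (m*n/n≡m q 3))

⌈m+q*3/3⌉ : ∀ m q → ⌈ m + q * 3 /3⌉ ≡ ⌈ m /3⌉ + q
⌈m+q*3/3⌉ m q = trans (cong (_/ 3) (xy∙z≈xz∙y m (q * 3) 2)) ([m+q*3]/3 (m + 2) q)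

[m+q*3]%3 : ∀ m q → (m + q * 3) % 3 ≡ m % 3
[m+q*3]%3 m q = [m+kn]%n≡m%n m q 3

⌈/3⌉-least : ∀ {a m} → a ≤ m * 3 → ⌈ a /3⌉ ≤ m
⌈/3⌉-least {m = m} a≤3m = ≤-trans (/-monoˡ-≤ 3 (+-monoˡ-≤ 2 a≤3m)) (≤-reflexive (⌈m+q*3/3⌉ 0 m))

⌈q*3∸1/3⌉ : ∀ q → ⌈ q * 3 ∸ 1 /3⌉ ≡ q
⌈q*3∸1/3⌉ zero = refl
⌈q*3∸1/3⌉ (suc q) = ⌈m+q*3/3⌉ 2 q

suc⌈q*3/3⌉ : ∀ r q → ⌈ r /3⌉ ≡ 1 → suc ⌈ q * 3 /3⌉ ≡ ⌈ r + q * 3 /3⌉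
suc⌈q*3/3⌉ r q ⌈r/3⌉≡1 = trans (cong suc (⌈m+q*3/3⌉ 0 q)) (sym (trans (⌈m+q*3/3⌉ r q) (cong (_+ q) ⌈r/3⌉≡1)))

record IsSplitList (G : Graph n) (K : List (Fin n)) : Set where
  field
    clique      : IsCliqueList G K
    independent : ∀ {x y} → x ∉ K → y ∉ K → ¬ Edge G x y

split-toList : (G : Graph n) → IsSplit G → Σ (List (Fin n)) (IsSplitList G)
split-toList G (K , K-clique , K̅-independent) = toList K , record
  { clique = clique-toList G K-clique
  ; independent = λ x∉ y∉ → K̅-independent _ _ (x∉p⇒x∈∁p (x∉ ∘ ∈-toList⁺ K)) (x∉p⇒x∈∁p (y∉ ∘ ∈-toList⁺ K))
  }

split-fromList : (G : Graph n) {K : List (Fin n)} → IsSplitList G K → IsSplit G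
split-fromList G {K} K-split = fromList K , clique-fromList G (IsSplitList.clique K-split) ,
  λ x y x∈ y∈ → IsSplitList.independent K-split (x∈∁p⇒x∉p x∈ ∘ ∈-fromList⁺ K) (x∈∁p⇒x∉p y∈ ∘ ∈-fromList⁺ K)

module _ (G : Graph n) {K : List (Fin n)} (K-split : IsSplitList G K) where
  open IsSplitList K-split

  colouring-by-non-neighbours : (∀ {v} → v ∉ K → ∃ λ w → w ∈ K × ¬ Edge G v w) → Colorable (Edge G) (length K)
  colouring-by-non-neighbours non-neighbour = colour , proper
    where
    colour : Fin n → Fin (length K)
    colour x with x ∈? K
    ... | yes x∈K = Any.index x∈K
    ... | no x∉K = Any.index (proj₁ (proj₂ (non-neighbour x∉K)))
    proper : ∀ x y → Edge G x y → colour x ≢ colour y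
    proper x y xy cx≡cy with x ∈? K | y ∈? K
    ... | yes x∈K | yes y∈K = Edge⇒≢ G xy (index-injective x∈K y∈K cx≡cy)
    ... | yes x∈K | no y∉K = let (w , w∈K , ¬y~w) = non-neighbour y∉K in
      ¬y~w (subst (Edge G y) (index-injective x∈K w∈K cx≡cy) (Edge-sym G xy))
    ... | no x∉K | yes y∈K = let (w , w∈K , ¬x~w) = non-neighbour x∉K in
      ¬x~w (subst (Edge G x) (index-injective y∈K w∈K (sym cx≡cy)) xy)
    ... | no x∉K | no y∉K = independent x∉K y∉K xy

  colouring-with-outside-colour : Colorable (Edge G) (suc (length K))
  colouring-with-outside-colour = colour , proper
    where
    colour : Fin n → Fin (suc (length K))
    colour x with x ∈? K
    ... | yes x∈K = suc (Any.index x∈K)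
    ... | no _ = zero
    proper : ∀ x y → Edge G x y → colour x ≢ colour y
    proper x y xy cx≡cy with x ∈? K | y ∈? K
    ... | yes x∈K | yes y∈K = Edge⇒≢ G xy (index-injective x∈K y∈K (fsuc-injective cx≡cy))
    ... | no x∉K | no y∉K = independent x∉K y∉K xy

  split-maximum-clique : ∀ {χ} → χ≡ G χ → Σ (List (Fin n)) λ Q → IsSplitList G Q × length Q ≡ χ
  split-maximum-clique χ-G with any? (λ v → ¬? (v ∈? K) ×-dec All.all? (Edge? G v) K)
  ... | yes (v , v∉K , v~K) =
    v ∷ K , Q-split , clique-colouring⇒χ G χ-G (IsSplitList.clique Q-split) colouring-with-outside-colour
    where
    Q-split : IsSplitList G (v ∷ K)
    Q-split = record
      { clique = ∷-clique clique v∉K (All.lookup v~K)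
      ; independent = λ x∉ y∉ → independent (x∉ ∘ there) (y∉ ∘ there)
      }
  ... | no no-extension = K , K-split , clique-colouring⇒χ G χ-G clique (colouring-by-non-neighbours non-neighbour)
    where
    non-neighbour : ∀ {v} → v ∉ K → ∃ λ w → w ∈ K × ¬ Edge G v w
    non-neighbour {v} v∉K = find (¬All⇒Any¬ (Edge? G v) K λ v~K → no-extension (v , v∉K , v~K))

split-colouring : (G : Graph n) {Q : List (Fin n)} → IsSplitList G Q →
  Σ (OneSelection G) λ F → Colorable (RemovedEdge G (proj₁ F)) (suc ⌈ length Q ∸ 1 /3⌉)
split-colouring G {[]} Q-split = ((λ _ → nothing) , λ _ _ ()) ,
  (λ _ → zero) , λ x y (xy , _) → ⊥-elim (IsSplitList.independent Q-split (λ ()) (λ ()) xy)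
split-colouring G {s ∷ R} Q-split =
  HubColouring.hub-colouring G clique independent (single s) ([] ∷ []) (λ { ∈₁ → ∈₁ }) s (λ { _ ∈₁ _ → refl })
  where open IsSplitList Q-split

split-χ₁≤ : (G : Graph n) {Q : List (Fin n)} → IsSplitList G Q → {χ₁ : ℕ} → χ₁≡ G χ₁ → χ₁ ≤ suc ⌈ length Q ∸ 1 /3⌉
split-χ₁≤ G Q-split χ₁-G = χ₁≤colours G χ₁-G (proj₁ (split-colouring G Q-split)) (proj₂ (split-colouring G Q-split))

module SplitBounds (G : Graph n) {Q : List (Fin n)} (Q-split : IsSplitList G Q) {χ χ₁ : ℕ}
  (|Q|≡χ : length Q ≡ χ) (χ₁-G : χ₁≡ G χ₁) where

  χ₁-≥ : ⌈ χ /3⌉ ≤ χ₁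
  χ₁-≥ = ⌈/3⌉-least (subst (_≤ χ₁ * 3) |Q|≡χ (clique≤3χ₁ G χ₁-G (IsSplitList.clique Q-split)))

  χ₁-≤ : χ₁ ≤ suc ⌈ χ ∸ 1 /3⌉
  χ₁-≤ = subst (λ l → χ₁ ≤ suc ⌈ l ∸ 1 /3⌉) |Q|≡χ (split-χ₁≤ G Q-split χ₁-G)

split-maximum : (G : Graph n) → IsSplit G → ∀ {χ} → χ≡ G χ → Σ (List (Fin n)) λ Q → IsSplitList G Q × length Q ≡ χ
split-maximum G G-split χ-G = split-maximum-clique G (proj₂ (split-toList G G-split)) χ-G

split-χ₁-upper : ∀ n (G : Graph n) χ χ₁ → IsSplit G → χ≡ G χ → χ₁≡ G χ₁ → χ₁ ≤ ⌈ χ ∸ 1 /3⌉ + 1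
split-χ₁-upper n G χ χ₁ G-split χ-G χ₁-G =
  let (Q , Q-split , |Q|≡χ) = split-maximum G G-split χ-G
  in subst (χ₁ ≤_) (+-comm 1 _) (SplitBounds.χ₁-≤ G Q-split |Q|≡χ χ₁-G)

split-χ₁-mod1 : ∀ n (G : Graph n) χ χ₁ → IsSplit G → χ≡ G χ → χ₁≡ G χ₁ → χ % 3 ≡ 1 → χ₁ ≡ (χ + 2) / 3
split-χ₁-mod1 n G χ χ₁ G-split χ-G χ₁-G χ%3≡1 with residue3 χ
... | mul3 q = contradiction (trans (sym ([m+q*3]%3 0 q)) χ%3≡1) λ ()
... | mul3+2 q = contradiction (trans (sym ([m+q*3]%3 2 q)) χ%3≡1) λ ()
... | mul3+1 q =
  let (Q , Q-split , |Q|≡χ) = split-maximum G G-split χ-G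
      open SplitBounds G Q-split |Q|≡χ χ₁-G
  in ≤-antisym (≤-trans χ₁-≤ (≤-reflexive (trans (cong suc (⌈m+q*3/3⌉ 0 q)) (sym (⌈m+q*3/3⌉ 1 q))))) χ₁-≥

-- Threshold graphs

lightest : (g : Fin n → ℚ.ℚ) {L : List (Fin n)} {x : Fin n} → x ∈ L → ∃ λ m → m ∈ L × (∀ {z} → z ∈ L → g m ℚ.≤ g z)
lightest g {a ∷ L} _ = argmin g a L , [ here , there ]′ (argmin-sel g a L) ,
  λ { (here refl) → f[argmin]≤f[⊤] {f = g} a L ; (there z∈L) → All.lookup (f[argmin]≤f[xs] {f = g} a L) z∈L }

module Threshold (G : Graph n) (h : ℚ.ℚ) (g : Fin n → ℚ.ℚ)
  (threshold : ∀ x y → x ≢ y → (Edge G x y ⇔ h ℚ.< g x ℚ.+ g y)) where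

  edge : ∀ {x y} → x ≢ y → h ℚ.< g x ℚ.+ g y → Edge G x y
  edge {x} {y} x≢y = Equivalence.from (threshold x y x≢y)

  edge-weight : ∀ {x y} → Edge G x y → h ℚ.< g x ℚ.+ g y
  edge-weight {x} {y} xy = Equivalence.to (threshold x y (Edge⇒≢ G xy)) xy

  edge-to-heavier : ∀ {v x y} → Edge G v x → v ≢ y → g x ℚ.≤ g y → Edge G v y
  edge-to-heavier {v} v~x v≢y gx≤gy = edge v≢y (ℚ.<-≤-trans (edge-weight v~x) (ℚ.+-mono-≤ (ℚ.≤-refl {g v}) gx≤gy))

  heavy-split : IsSplitList G (filter (λ x → h ℚ.<? g x ℚ.+ g x) (allFin n))
  heavy-split = record
    { clique = record { distinct = Unique.filter⁺ _ (Unique.allFin⁺ n) ; adjacent = adjacent′ }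
    ; independent = independent′
    }
    where
    heavy : ∀ {x} → x ∈ filter (λ x → h ℚ.<? g x ℚ.+ g x) (allFin n) → h ℚ.< g x ℚ.+ g x
    heavy = proj₂ ∘ ∈-filter⁻ (λ x → h ℚ.<? g x ℚ.+ g x) {xs = allFin n}
    light : ∀ {x} → x ∉ filter (λ x → h ℚ.<? g x ℚ.+ g x) (allFin n) → g x ℚ.+ g x ℚ.≤ h
    light {x} x∉ = ℚ.≮⇒≥ (x∉ ∘ ∈-filter⁺ (λ x → h ℚ.<? g x ℚ.+ g x) (∈-allFin x))
    adjacent′ : ∀ {x y} → _ → _ → x ≢ y → Edge G x y
    adjacent′ {x} {y} x∈ y∈ x≢y with ℚ.≤-total (g x) (g y)
    ... | inj₁ gx≤gy = edge x≢y (ℚ.<-≤-trans (heavy x∈) (ℚ.+-mono-≤ (ℚ.≤-refl {g x}) gx≤gy))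
    ... | inj₂ gy≤gx = edge x≢y (ℚ.<-≤-trans (heavy y∈) (ℚ.+-mono-≤ gy≤gx ℚ.≤-refl))
    independent′ : ∀ {x y} → _ → _ → ¬ Edge G x y
    independent′ {x} {y} x∉ y∉ xy with ℚ.≤-total (g x) (g y)
    ... | inj₁ gx≤gy = ℚ.<-irrefl refl (ℚ.<-≤-trans (edge-weight xy) (ℚ.≤-trans (ℚ.+-mono-≤ gx≤gy ℚ.≤-refl) (light y∉)))
    ... | inj₂ gy≤gx =
      ℚ.<-irrefl refl (ℚ.<-≤-trans (edge-weight xy) (ℚ.≤-trans (ℚ.+-mono-≤ (ℚ.≤-refl {g x}) gy≤gx) (light x∉)))

  Lightest : List (Fin n) → Fin n → Set
  Lightest L m = m ∈ L × ∀ {z} → z ∈ L → g m ℚ.≤ g z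

  neighbour-of-lightest : {L : List (Fin n)} → IsCliqueList G L → ∀ {m v} → Lightest L m → v ∉ L → Edge G v m →
    IsCliqueList G (v ∷ L)
  neighbour-of-lightest L-clique (_ , m-lightest) v∉L v~m =
    ∷-clique L-clique v∉L λ y∈L → edge-to-heavier v~m (λ { refl → v∉L y∈L }) (m-lightest y∈L)

  -- Otherwise replacing a by b would give a second clique of size 3k.
  tight-clique-heaviest : {f : Fin n → Maybe (Fin n)} → (∀ v u → f v ≡ just u → Edge G v u) →
    {c : Fin n → Fin k} → (∀ x y → RemovedEdge G f x y → c x ≢ c y) →
    {A : List (Fin n)} → IsCliqueList G A → length A ≡ k * 3 → ∀ {a b} → a ∈ A → b ∉ A → g a ℚ.≤ g b → ⊥
  tight-clique-heaviest {k = k} f-valid proper {A} A-clique A-tight {a} {b} a∈A b∉A ga≤gb =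
    TightCliques.no-exchange G f-valid proper A-clique A′-clique A-tight A′-tight a∈A a∉A′
      λ y∈A y≢a → there (∈-remove⁺ y∈A y≢a)
    where
    A′ = b ∷ remove a A
    A′-clique : IsCliqueList G A′
    A′-clique = ∷-clique (remove-clique A-clique a) (b∉A ∘ proj₁ ∘ ∈-remove⁻ {x = a} {L = A}) λ y∈ →
      let (y∈A , y≢a) = ∈-remove⁻ {x = a} {L = A} y∈ in
      Edge-sym G (edge-to-heavier (adjacent A-clique y∈A a∈A y≢a) (λ { refl → b∉A y∈A }) ga≤gb)
    A′-tight : length A′ ≡ k * 3
    A′-tight = trans (length-remove (distinct A-clique) a∈A) A-tight
    a∉A′ : a ∉ A′
    a∉A′ (here refl) = b∉A a∈A
    a∉A′ (there a∈) = ∉-remove a A a∈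

  module MaximumClique {Q : List (Fin n)} (Q-split : IsSplitList G Q) {χ : ℕ} (χ-G : χ≡ G χ)
    (|Q|≡χ : length Q ≡ χ) where
    open IsSplitList Q-split

    lightest-isolated : ∀ {q} → Lightest Q q → ∀ {v} → v ∉ Q → ¬ Edge G v q
    lightest-isolated q-lightest v∉Q v~q =
      <-irrefl |Q|≡χ (clique≤colours G (proj₁ χ-G) (neighbour-of-lightest clique q-lightest v∉Q v~q))

    second-lightest-isolated : ωUnique G → ∀ {q p} → q ∈ Q → Lightest (remove q Q) p → ∀ {v} → v ∉ Q → ¬ Edge G v p
    second-lightest-isolated ω-unique {q} q∈Q p-lightest {v} v∉Q v~p =
      v∉Q (ω-unique-⊆ G χ-G ω-unique Q′-clique clique |Q′|≡χ |Q|≡χ (here refl))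
      where
      Q′-clique : IsCliqueList G (v ∷ remove q Q)
      Q′-clique = neighbour-of-lightest (remove-clique clique q) p-lightest
                    (v∉Q ∘ proj₁ ∘ ∈-remove⁻ {x = q} {L = Q}) v~p
      |Q′|≡χ : length (v ∷ remove q Q) ≡ χ
      |Q′|≡χ = trans (length-remove (distinct clique) q∈Q) |Q|≡χ

    tight⇒ω-unique : ∀ {χ₁} → χ₁≡ G χ₁ → χ ≡ χ₁ * 3 → ωUnique G
    tight⇒ω-unique (((f , f-valid) , (c , proper) , _) , _) χ≡3χ₁ = ω-unique-if G χ-G clique |Q|≡χ T⊆Q
      where
      |toList|≡ : ∀ {T} → ∣ T ∣ ≡ χ → length (toList T) ≡ χ
      |toList|≡ {T} ∣T∣≡χ = trans (length-toList T) ∣T∣≡χ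
      T⊆Q : ∀ {T} → IsClique G T → ∣ T ∣ ≡ χ → toList T ⊆ Q
      T⊆Q {T} T-clique ∣T∣≡χ {x} x∈T with x ∈? Q | All.all? (_∈? toList T) Q
      ... | yes x∈Q | _ = x∈Q
      ... | no x∉Q | yes Q⊆T = ⊆-length⇒⊇ (distinct clique) (toList-unique T) (All.lookup Q⊆T)
                                 (≤-reflexive (trans (|toList|≡ {T} ∣T∣≡χ) (sym |Q|≡χ))) x∈T
      ... | no x∉Q | no Q⊈T with find (¬All⇒Any¬ (_∈? toList T) Q Q⊈T)
      ...   | u , u∈Q , u∉T with ℚ.≤-total (g x) (g u)
      ...     | inj₁ gx≤gu = ⊥-elim (tight-clique-heaviest f-valid proper (clique-toList G T-clique)
                                      (trans (|toList|≡ {T} ∣T∣≡χ) χ≡3χ₁) x∈T u∉T gx≤gu)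
      ...     | inj₂ gu≤gx = ⊥-elim (tight-clique-heaviest f-valid proper clique (trans |Q|≡χ χ≡3χ₁) u∈Q x∉Q gu≤gx)

    pair-bound : ∀ {χ₁ m} → χ₁≡ G χ₁ → length Q ≡ 2 + m → χ₁ ≤ suc ⌈ m /3⌉
    pair-bound χ₁-G |Q|≡2+m with lightest g (proj₂ (nonempty-member Q |Q|≡2+m))
    ... | q , q-lightest@(q∈Q , _)
      with nonempty-member (remove q Q) (suc-injective (trans (length-remove (distinct clique) q∈Q) |Q|≡2+m))
    ... | p , p∈Q∖q with ∈-remove⁻ {x = q} {L = Q} p∈Q∖q
    ... | p∈Q , p≢q =
      let (F , colouring) = HubColouring.hub-colouring G clique independent (pair q p) ((≢-sym p≢q ∷ []) ∷ [] ∷ [])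
                              (λ { ∈₁ → q∈Q ; ∈₂ → p∈Q }) p hub-only
      in χ₁≤colours G χ₁-G F (Colorable-≤ colouring (≤-reflexive (cong (λ l → suc ⌈ l ∸ 2 /3⌉) |Q|≡2+m)))
      where
      hub-only : ∀ {v b} → v ∉ Q → b ∈ q ∷ p ∷ [] → Edge G v b → b ≡ p
      hub-only v∉Q ∈₁ v~q = ⊥-elim (lightest-isolated q-lightest v∉Q v~q)
      hub-only _ ∈₂ _ = refl

    triangle-bound : ωUnique G → ∀ {χ₁ m} → χ₁≡ G χ₁ → length Q ≡ 3 + m → χ₁ ≤ suc ⌈ m /3⌉
    triangle-bound ω-unique {m = m} χ₁-G |Q|≡3+m =
      let (F , colouring) = HubColouring.hub-colouring G clique independent (triangle q p a) distinct-qpa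
                              (λ { ∈₁ → q∈Q ; ∈₂ → p∈Q ; ∈₃ → a∈Q }) a hub-only
      in χ₁≤colours G χ₁-G F (Colorable-≤ colouring (≤-reflexive (cong (λ l → suc ⌈ l ∸ 3 /3⌉) |Q|≡3+m)))
      where
      lightest-q = lightest g (proj₂ (nonempty-member Q |Q|≡3+m))
      q = proj₁ lightest-q
      q∈Q = proj₁ (proj₂ lightest-q)
      |Q∖q|≡2+m : length (remove q Q) ≡ 2 + m
      |Q∖q|≡2+m = suc-injective (trans (length-remove (distinct clique) q∈Q) |Q|≡3+m)
      lightest-p = lightest g (proj₂ (nonempty-member (remove q Q) |Q∖q|≡2+m))
      p = proj₁ lightest-p
      p∈Q∖q = proj₁ (proj₂ lightest-p)
      |Q∖q∖p|≡1+m : length (remove p (remove q Q)) ≡ 1 + m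
      |Q∖q∖p|≡1+m = suc-injective (trans (length-remove (remove-unique q (distinct clique)) p∈Q∖q) |Q∖q|≡2+m)
      a = proj₁ (nonempty-member (remove p (remove q Q)) |Q∖q∖p|≡1+m)
      a∈Q∖q∖p = proj₂ (nonempty-member (remove p (remove q Q)) |Q∖q∖p|≡1+m)
      p∈Q = proj₁ (∈-remove⁻ {x = q} {L = Q} p∈Q∖q)
      a∈Q∖q = proj₁ (∈-remove⁻ {x = p} {L = remove q Q} a∈Q∖q∖p)
      a∈Q = proj₁ (∈-remove⁻ {x = q} {L = Q} a∈Q∖q)
      distinct-qpa : Unique (q ∷ p ∷ a ∷ [])
      distinct-qpa =
        (≢-sym (proj₂ (∈-remove⁻ {x = q} {L = Q} p∈Q∖q)) ∷ ≢-sym (proj₂ (∈-remove⁻ {x = q} {L = Q} a∈Q∖q)) ∷ [])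
        ∷ (≢-sym (proj₂ (∈-remove⁻ {x = p} {L = remove q Q} a∈Q∖q∖p)) ∷ []) ∷ [] ∷ []
      hub-only : ∀ {v b} → v ∉ Q → b ∈ q ∷ p ∷ a ∷ [] → Edge G v b → b ≡ a
      hub-only v∉Q ∈₁ v~q = ⊥-elim (lightest-isolated (proj₂ lightest-q) v∉Q v~q)
      hub-only v∉Q ∈₂ v~p = ⊥-elim (second-lightest-isolated ω-unique q∈Q (proj₂ lightest-p) v∉Q v~p)
      hub-only _ ∈₃ _ = refl

module ThresholdBounds (G : Graph n) (h : ℚ.ℚ) (g : Fin n → ℚ.ℚ)
  (threshold : ∀ x y → x ≢ y → (Edge G x y ⇔ h ℚ.< g x ℚ.+ g y))
  {χ₁ : ℕ} (χ₁-G : χ₁≡ G χ₁) where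
  open Threshold G h g threshold

  module _ {χ : ℕ} (χ-G : χ≡ G χ) where
    private
      maximum = split-maximum-clique G heavy-split χ-G
    Q : List (Fin n)
    Q = proj₁ maximum
    |Q|≡χ : length Q ≡ χ
    |Q|≡χ = proj₂ (proj₂ maximum)
    open MaximumClique (proj₁ (proj₂ maximum)) χ-G |Q|≡χ public
    open SplitBounds G (proj₁ (proj₂ maximum)) |Q|≡χ χ₁-G public

  χ₁≤⌈χ/3⌉ : ∀ {χ} → χ≡ G χ → Residue3 χ → ¬ (χ % 3 ≡ 0 × ¬ ωUnique G) → χ₁ ≤ ⌈ χ /3⌉
  χ₁≤⌈χ/3⌉ χ-G (mul3 zero) _ = χ₁≤χ G χ-G χ₁-G
  -- Here ω-uniqueness is only known doubly negated, but the goal is decidable.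
  χ₁≤⌈χ/3⌉ χ-G (mul3 (suc q)) not-exceptional with χ₁ ≤? ⌈ suc q * 3 /3⌉
  ... | yes χ₁≤ = χ₁≤
  ... | no χ₁≰ = ⊥-elim (not-exceptional ([m+q*3]%3 0 (suc q) , λ ω-unique →
        χ₁≰ (≤-trans (triangle-bound χ-G ω-unique χ₁-G (|Q|≡χ χ-G)) (≤-reflexive (suc⌈q*3/3⌉ 3 q refl)))))
  χ₁≤⌈χ/3⌉ χ-G (mul3+1 q) _ = ≤-trans (χ₁-≤ χ-G) (≤-reflexive (suc⌈q*3/3⌉ 1 q refl))
  χ₁≤⌈χ/3⌉ χ-G (mul3+2 q) _ = ≤-trans (pair-bound χ-G χ₁-G (|Q|≡χ χ-G)) (≤-reflexive (suc⌈q*3/3⌉ 2 q refl))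

  exceptional : ∀ {χ} → χ≡ G χ → Residue3 χ → χ % 3 ≡ 0 → ¬ ωUnique G → χ₁ ≡ χ / 3 + 1
  exceptional χ-G (mul3+1 q) χ%3≡0 _ = contradiction (trans (sym ([m+q*3]%3 1 q)) χ%3≡0) λ ()
  exceptional χ-G (mul3+2 q) χ%3≡0 _ = contradiction (trans (sym ([m+q*3]%3 2 q)) χ%3≡0) λ ()
  exceptional χ-G (mul3 q) _ not-unique = begin-equality
    χ₁              ≡⟨ ≤-antisym (≤-trans (χ₁-≤ χ-G) (≤-reflexive (cong suc (⌈q*3∸1/3⌉ q)))) q<χ₁ ⟩
    suc q           ≡⟨ +-comm 1 q ⟩
    q + 1           ≡⟨ cong (_+ 1) (sym ([m+q*3]/3 0 q)) ⟩
    q * 3 / 3 + 1   ∎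
    where
    open ≤-Reasoning
    q≤χ₁ : q ≤ χ₁
    q≤χ₁ = subst (_≤ χ₁) (⌈m+q*3/3⌉ 0 q) (χ₁-≥ χ-G)
    q<χ₁ : q < χ₁
    q<χ₁ = ≤∧≢⇒< q≤χ₁ λ { refl → not-unique (tight⇒ω-unique χ-G χ₁-G refl) }

threshold-χ₁ : ∀ n (G : Graph n) χ χ₁ → IsThreshold G → χ≡ G χ → χ₁≡ G χ₁ →
  ((χ % 3 ≡ 0 × ¬ ωUnique G) → χ₁ ≡ χ / 3 + 1) × (¬ (χ % 3 ≡ 0 × ¬ ωUnique G) → χ₁ ≡ ⌈ χ /3⌉)
threshold-χ₁ n G χ χ₁ (h , g , threshold) χ-G χ₁-G =
  (λ (χ%3≡0 , not-unique) → exceptional χ-G (residue3 χ) χ%3≡0 not-unique) ,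
  (λ not-exceptional → ≤-antisym (χ₁≤⌈χ/3⌉ χ-G (residue3 χ) not-exceptional) (χ₁-≥ χ-G))
  where open ThresholdBounds G h g threshold χ₁-G

-- Split graphs attaining the bound

module RelationGraph {R : Fin n → Fin n → Set} (R? : ∀ x y → Dec (R x y)) (R-sym : ∀ {x y} → R x y → R y x)
  (R-irrefl : ∀ {x} → ¬ R x x) where

  relationGraph : Graph n
  relationGraph = record { adj = λ x y → does (R? x y) ; sym = adj-sym ; irrefl = λ x → dec-false (R? x x) R-irrefl }
    where
    adj-sym : ∀ x y → does (R? x y) ≡ does (R? y x)
    adj-sym x y with R? x y | R? y x
    ... | yes _ | yes _ = refl
    ... | no _ | no _ = refl
    ... | yes r | no ¬r = ⊥-elim (¬r (R-sym r))
    ... | no ¬r | yes r = ⊥-elim (¬r (R-sym r))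

  edge⁺ : ∀ {x y} → R x y → Edge relationGraph x y
  edge⁺ {x} {y} = dec-true (R? x y)

  edge⁻ : ∀ {x y} → Edge relationGraph x y → R x y
  edge⁻ {x} {y} xy with R? x y
  ... | yes r = r

extremal : (G : Graph n) {K : List (Fin n)} → IsSplitList G K → ∀ {t} → length K ≡ t → Colorable (Edge G) t →
  (∀ (F : OneSelection G) {m} → Colorable (RemovedEdge G (proj₁ F)) m → ⌈ t ∸ 1 /3⌉ + 1 ≤ m) →
  IsSplit G × χ≡ G t × χ₁≡ G (⌈ t ∸ 1 /3⌉ + 1)
extremal G {K} K-split {t} |K|≡t colouring least =
  split-fromList G K-split ,
  (colouring , λ m colouring′ → subst (_≤ m) |K|≡t (clique≤colours G colouring′ (IsSplitList.clique K-split))) ,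
  (F , Colorable-≤ F-colouring (≤-reflexive F-colours) , λ _ → least F) ,
  λ F′ m χ-m → least F′ (proj₁ χ-m)
  where
  optimal = split-colouring G K-split
  F = proj₁ optimal
  F-colouring = proj₂ optimal
  F-colours : suc ⌈ length K ∸ 1 /3⌉ ≡ ⌈ t ∸ 1 /3⌉ + 1
  F-colours = trans (cong (λ l → suc ⌈ l ∸ 1 /3⌉) |K|≡t) (+-comm 1 _)

module Complete (q : ℕ) where
  t = 1 + q * 3
  open RelationGraph {R = _≢_ {A = Fin t}} (λ x y → ¬? (x ≟ y)) ≢-sym (λ x≢x → x≢x refl)
    renaming (relationGraph to G) public

  clique : IsCliqueList G (allFin t)
  clique = record { distinct = Unique.allFin⁺ t ; adjacent = λ _ _ → edge⁺ }

  complete-extremal : IsSplit G × χ≡ G t × χ₁≡ G (⌈ t ∸ 1 /3⌉ + 1)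
  complete-extremal = extremal G split (length-allFin t) ((λ x → x) , λ _ _ → edge⁻) least
    where
    split : IsSplitList G (allFin t)
    split = record { clique = clique ; independent = λ x∉ _ → ⊥-elim (x∉ (∈-allFin _)) }
    least : ∀ (F : OneSelection G) {m} → Colorable (RemovedEdge G (proj₁ F)) m → ⌈ t ∸ 1 /3⌉ + 1 ≤ m
    least F {m} (_ , proper) = subst (_≤ m) (trans (sym (suc⌈q*3/3⌉ 1 q refl)) (+-comm 1 _))
      (⌈/3⌉-least (subst (_≤ m * 3) (length-allFin t) (SelectionOnClique.length≤ G proper clique)))

module CompleteMinusEdge (j : ℕ) where
  t = suc j * 3

  -- The missing edge {0, 1} is the only pair of distinct vertices with index sum 1.
  NonEdge01 : Fin (suc t) → Fin (suc t) → Set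
  NonEdge01 x y = x ≢ y × toℕ x + toℕ y ≢ 1

  open RelationGraph {R = NonEdge01} (λ x y → ¬? (x ≟ y) ×-dec ¬? (toℕ x + toℕ y ℕ.≟ 1))
    (λ {x} {y} (x≢y , sum≢1) → ≢-sym x≢y , sum≢1 ∘ trans (+-comm (toℕ x) (toℕ y))) (λ (x≢x , _) → x≢x refl)
    renaming (relationGraph to G) public

  sum≡1 : ∀ {x y : Fin (suc t)} → toℕ x + toℕ y ≡ 1 → (x ≡ zero × y ≡ suc zero) ⊎ (x ≡ suc zero × y ≡ zero)
  sum≡1 {zero} {suc zero} _ = inj₁ (refl , refl)
  sum≡1 {suc zero} {zero} _ = inj₂ (refl , refl)

  without : Fin (suc t) → List (Fin (suc t))
  without v = remove v (allFin (suc t))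

  |without|≡t : ∀ v → length (without v) ≡ t
  |without|≡t v = suc-injective (trans (length-remove (Unique.allFin⁺ (suc t)) (∈-allFin v)) (length-allFin (suc t)))

  without-clique : ∀ v → (∀ {x y} → x ≢ v → y ≢ v → toℕ x + toℕ y ≢ 1) → IsCliqueList G (without v)
  without-clique v no-sum-1 = record
    { distinct = remove-unique v (Unique.allFin⁺ (suc t))
    ; adjacent = λ {x} {y} x∈ y∈ x≢y → edge⁺ {x} {y} (x≢y , no-sum-1 (proj₂ (∈-remove⁻ {x = v} {L = allFin (suc t)} x∈))
                                                           (proj₂ (∈-remove⁻ {x = v} {L = allFin (suc t)} y∈)))
    }

  without-0 : IsCliqueList G (without zero)
  without-0 = without-clique zero λ x≢0 y≢0 sum≡1′ → [ x≢0 ∘ proj₁ , y≢0 ∘ proj₂ ]′ (sum≡1 sum≡1′)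

  without-1 : IsCliqueList G (without (suc zero))
  without-1 = without-clique (suc zero) λ x≢1 y≢1 sum≡1′ → [ y≢1 ∘ proj₂ , x≢1 ∘ proj₁ ]′ (sum≡1 sum≡1′)

  colour : Fin (suc t) → Fin t
  colour zero = zero
  colour (suc i) = i

  colour-proper : ∀ x y → Edge G x y → colour x ≢ colour y
  colour-proper x y xy cx≡cy with edge⁻ {x} {y} xy
  colour-proper zero zero _ _ | x≢y , _ = x≢y refl
  colour-proper zero (suc _) _ refl | _ , sum≢1 = sum≢1 refl
  colour-proper (suc _) zero _ refl | _ , sum≢1 = sum≢1 refl
  colour-proper (suc _) (suc _) _ refl | x≢y , _ = x≢y refl

  minus-edge-extremal : IsSplit G × χ≡ G t × χ₁≡ G (⌈ t ∸ 1 /3⌉ + 1)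
  minus-edge-extremal = extremal G split (|without|≡t zero) (colour , colour-proper) least
    where
    outside-0 : ∀ {x} → x ∉ without zero → x ≡ zero
    outside-0 {x} x∉ with x ≟ zero
    ... | yes x≡0 = x≡0
    ... | no x≢0 = ⊥-elim (x∉ (∈-remove⁺ (∈-allFin x) x≢0))
    split : IsSplitList G (without zero)
    split = record
      { clique = without-0
      ; independent = λ x∉ y∉ xy → Edge⇒≢ G xy (trans (outside-0 x∉) (sym (outside-0 y∉)))
      }
    least : ∀ (F : OneSelection G) {m} → Colorable (RemovedEdge G (proj₁ F)) m →
      ⌈ t ∸ 1 /3⌉ + 1 ≤ m
    least (f , f-valid) {m} (c , proper) with m≤n⇒m<n∨m≡n suc-j≤m
      where
      suc-j≤m : suc j ≤ m
      suc-j≤m = subst (_≤ m) (⌈m+q*3/3⌉ 0 (suc j))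
        (⌈/3⌉-least (subst (_≤ m * 3) (|without|≡t zero) (SelectionOnClique.length≤ G proper without-0)))
    ... | inj₁ suc-j<m = subst (_≤ m) (trans (+-comm 1 (suc j)) (cong (_+ 1) (sym (⌈q*3∸1/3⌉ (suc j))))) suc-j<m
    ... | inj₂ refl = ⊥-elim (TightCliques.no-exchange G f-valid proper without-0 without-1
            (|without|≡t zero) (|without|≡t (suc zero)) (∈-remove⁺ {x = zero} (∈-allFin (suc zero)) λ ())
            (∉-remove (suc zero) (allFin (suc t)))
            λ y∈ y≢1 → ∈-remove⁺ (proj₁ (∈-remove⁻ {x = zero} {L = allFin (suc t)} y∈)) y≢1)

-- Vertices i ↑ˡ t form the clique; the twin t ↑ʳ i of i is adjacent to all other clique vertices.
module CliqueWithTwins (q : ℕ) where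
  t = 2 + suc q * 3

  Adjacent : Fin t ⊎ Fin t → Fin t ⊎ Fin t → Set
  Adjacent (inj₁ i) (inj₁ j) = i ≢ j
  Adjacent (inj₁ i) (inj₂ j) = i ≢ j
  Adjacent (inj₂ i) (inj₁ j) = i ≢ j
  Adjacent (inj₂ _) (inj₂ _) = ⊥

  Adjacent? : ∀ u v → Dec (Adjacent u v)
  Adjacent? (inj₁ i) (inj₁ j) = ¬? (i ≟ j)
  Adjacent? (inj₁ i) (inj₂ j) = ¬? (i ≟ j)
  Adjacent? (inj₂ i) (inj₁ j) = ¬? (i ≟ j)
  Adjacent? (inj₂ _) (inj₂ _) = no λ ()

  Adjacent-sym : ∀ {u v} → Adjacent u v → Adjacent v u
  Adjacent-sym {inj₁ _} {inj₁ _} = ≢-sym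
  Adjacent-sym {inj₁ _} {inj₂ _} = ≢-sym
  Adjacent-sym {inj₂ _} {inj₁ _} = ≢-sym

  Adjacent-irrefl : ∀ u → ¬ Adjacent u u
  Adjacent-irrefl (inj₁ _) i≢i = i≢i refl
  Adjacent-irrefl (inj₂ _) ()

  index : Fin t ⊎ Fin t → Fin t
  index = [ (λ i → i) , (λ i → i) ]′

  Adjacent⇒≢ : ∀ {u v} → Adjacent u v → index u ≢ index v
  Adjacent⇒≢ {inj₁ _} {inj₁ _} i≢j = i≢j
  Adjacent⇒≢ {inj₁ _} {inj₂ _} i≢j = i≢j
  Adjacent⇒≢ {inj₂ _} {inj₁ _} i≢j = i≢j

  open RelationGraph {R = λ x y → Adjacent (splitAt t x) (splitAt t y)} (λ x y → Adjacent? (splitAt t x) (splitAt t y))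
    Adjacent-sym (λ {x} → Adjacent-irrefl (splitAt t x))
    renaming (relationGraph to G) public

  left right : Fin t → Fin (t + t)
  left i = i ↑ˡ t
  right i = t ↑ʳ i

  edge-left : ∀ {i j} → i ≢ j → Edge G (left i) (left j)
  edge-left {i} {j} i≢j =
    edge⁺ {left i} {left j} (subst₂ Adjacent (sym (splitAt-↑ˡ t i t)) (sym (splitAt-↑ˡ t j t)) i≢j)

  edge-right-left : ∀ {i j} → i ≢ j → Edge G (right i) (left j)
  edge-right-left {i} {j} i≢j =
    edge⁺ {right i} {left j} (subst₂ Adjacent (sym (splitAt-↑ʳ t t i)) (sym (splitAt-↑ˡ t j t)) i≢j)

  no-edge-right : ∀ {i j} → ¬ Edge G (right i) (right j)
  no-edge-right {i} {j} e = subst₂ Adjacent (splitAt-↑ʳ t t i) (splitAt-↑ʳ t t j) (edge⁻ {right i} {right j} e)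

  K : List (Fin (t + t))
  K = map left (allFin t)

  ∈K : ∀ {x} → x ∈ K → ∃ λ i → x ≡ left i
  ∈K x∈K = let (i , _ , x≡) = ∈-map⁻ left x∈K in i , x≡

  ∉K : ∀ {x} → x ∉ K → ∃ λ i → x ≡ right i
  ∉K {x} x∉K with splitAt t x in eq
  ... | inj₁ i = ⊥-elim (x∉K (subst (_∈ K) (splitAt⁻¹-↑ˡ eq) (∈-map⁺ left (∈-allFin i))))
  ... | inj₂ i = i , sym (splitAt⁻¹-↑ʳ eq)

  right∉K : ∀ i → right i ∉ K
  right∉K i right∈K with ∈K right∈K
  ... | j , right≡left with () ← trans (sym (splitAt-↑ʳ t t i)) (trans (cong (splitAt t) right≡left) (splitAt-↑ˡ t j t))

  |K|≡t : length K ≡ t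
  |K|≡t = trans (length-map left (allFin t)) (length-allFin t)

  K-clique : IsCliqueList G K
  K-clique = record
    { distinct = Unique.map⁺ (↑ˡ-injective t _ _) (Unique.allFin⁺ t)
    ; adjacent = λ x∈ y∈ x≢y → left-adjacent (∈K x∈) (∈K y∈) x≢y
    }
    where
    left-adjacent : ∀ {x y} → ∃ (λ i → x ≡ left i) → ∃ (λ j → y ≡ left j) → x ≢ y → Edge G x y
    left-adjacent (i , refl) (j , refl) x≢y = edge-left (x≢y ∘ cong left)

  K-split : IsSplitList G K
  K-split = record { clique = K-clique ; independent = independent′ }
    where
    independent′ : ∀ {x y} → x ∉ K → y ∉ K → ¬ Edge G x y
    independent′ x∉ y∉ with ∉K x∉ | ∉K y∉
    ... | i , refl | j , refl = no-edge-right

  colour-proper : ∀ x y → Edge G x y → index (splitAt t x) ≢ index (splitAt t y)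
  colour-proper x y = Adjacent⇒≢ ∘ edge⁻ {x} {y}

  twin : Fin (t + t) → Fin (t + t)
  twin x = right (index (splitAt t x))

  twin-left : ∀ i → twin (left i) ≡ right i
  twin-left i = cong (right ∘ index) (splitAt-↑ˡ t i t)

  twin∉K : ∀ {x} → x ∈ K → twin x ∉ K
  twin∉K x∈K with ∈K x∈K
  ... | i , refl = subst (_∉ K) (sym (twin-left i)) (right∉K i)

  twin-clique : ∀ {x} → x ∈ K → IsCliqueList G (twin x ∷ remove x K)
  twin-clique {x} x∈K =
    ∷-clique (remove-clique K-clique x) (twin∉K x∈K ∘ proj₁ ∘ ∈-remove⁻ {x = x} {L = K}) twin-adjacent
    where
    twin-adjacent : ∀ {y} → y ∈ remove x K → Edge G (twin x) y
    twin-adjacent y∈ with ∈-remove⁻ {x = x} {L = K} y∈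
    ... | y∈K , y≢x with ∈K x∈K | ∈K y∈K
    ...   | i , refl | j , refl = subst (λ v → Edge G v (left j)) (sym (twin-left i))
                                    (edge-right-left {i} {j} λ { refl → y≢x refl })

  twin-injective : ∀ {x y} → x ∈ K → y ∈ K → twin x ≡ twin y → x ≡ y
  twin-injective x∈K y∈K twins≡ with ∈K x∈K | ∈K y∈K
  ... | i , refl | j , refl = cong left (↑ʳ-injective t i j (trans (sym (twin-left i)) (trans twins≡ (twin-left j))))

  twins-extremal : IsSplit G × χ≡ G t × χ₁≡ G (⌈ t ∸ 1 /3⌉ + 1)
  twins-extremal = extremal G K-split |K|≡t (index ∘ splitAt t , colour-proper) least
    where
    least : ∀ (F : OneSelection G) {m} → Colorable (RemovedEdge G (proj₁ F)) m →
      ⌈ t ∸ 1 /3⌉ + 1 ≤ m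
    least (f , f-valid) {m} (c , proper) with m≤n⇒m<n∨m≡n q+2≤m
      where
      q+2≤m : suc (suc q) ≤ m
      q+2≤m = subst (_≤ m) (⌈m+q*3/3⌉ 2 (suc q))
        (⌈/3⌉-least (subst (_≤ m * 3) |K|≡t (SelectionOnClique.length≤ G proper K-clique)))
    ... | inj₁ q+2<m = subst (_≤ m) (trans (+-comm 1 (suc (suc q))) (cong (_+ 1) (sym (⌈m+q*3/3⌉ 1 (suc q))))) q+2<m
    ... | inj₂ refl = ⊥-elim (<⇒≱ 2m<t (subst (_≤ m * 2) |K|≡t (length≤-colourClasses c 2 K λ j →
                        at-most-two (colourClass-unique c j K (distinct K-clique)) (no-triple j))))
      where
      2m<t : m * 2 < t
      2m<t = s≤s (s≤s (s≤s (s≤s (s≤s (*-monoʳ-≤ q (s≤s (s≤s z≤n)))))))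
      no-triple : ∀ j {x y z} → x ∈ colourClass c j K → y ∈ colourClass c j K → z ∈ colourClass c j K →
        x ≢ y → x ≢ z → y ≢ z → ⊥
      no-triple j x∈ y∈ z∈ x≢y x≢z y≢z =
        let (x∈K , cx≡j) = ∈-colourClass⁻ c j K x∈
            (y∈K , cy≡j) = ∈-colourClass⁻ c j K y∈
            (z∈K , cz≡j) = ∈-colourClass⁻ c j K z∈
        in TightCliques.no-monochromatic-triple G f-valid proper K-clique (cong suc |K|≡t)
             twin twin∉K twin-clique twin-injective x∈K y∈K z∈K x≢y x≢z y≢z
             (trans cx≡j (sym cy≡j)) (trans cx≡j (sym cz≡j))

split-extremal : ∀ t → t ≥ 3 → Σ ℕ λ n → Σ (Graph n) λ G → IsSplit G × χ≡ G t × χ₁≡ G (⌈ t ∸ 1 /3⌉ + 1)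
split-extremal t t≥3 with residue3 t
... | mul3 zero = contradiction t≥3 λ ()
... | mul3 (suc j) = _ , CompleteMinusEdge.G j , CompleteMinusEdge.minus-edge-extremal j
... | mul3+1 q = _ , Complete.G q , Complete.complete-extremal q
... | mul3+2 zero = contradiction t≥3 λ { (s≤s (s≤s ())) }
... | mul3+2 (suc q) = _ , CliqueWithTwins.G q , CliqueWithTwins.twins-extremal q

theorem1p1 :
    (∀ n (G : Graph n) χ χ₁ → IsThreshold G → χ≡ G χ → χ₁≡ G χ₁ →
      ((χ % 3 ≡ 0 × ¬ ωUnique G) → χ₁ ≡ χ / 3 + 1)
      × (¬ (χ % 3 ≡ 0 × ¬ ωUnique G) → χ₁ ≡ ⌈ χ /3⌉))
    × (∀ n (G : Graph n) χ χ₁ → IsSplit G → χ≡ G χ → χ₁≡ G χ₁ →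
      χ₁ ≤ ⌈ χ ∸ 1 /3⌉ + 1)
    × (∀ t → t ≥ 3 → Σ ℕ λ n → Σ (Graph n) λ G →
      IsSplit G × χ≡ G t × χ₁≡ G (⌈ t ∸ 1 /3⌉ + 1))
    × (∀ n (G : Graph n) χ χ₁ → IsSplit G → χ≡ G χ → χ₁≡ G χ₁ →
      χ % 3 ≡ 1 → χ₁ ≡ (χ + 2) / 3)
theorem1p1 = threshold-χ₁ , split-χ₁-upper , split-extremal , split-χ₁-mod1
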